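{- Let $A\in\mathbb Q\langle X\rangle=\mathcal U(\mathfrak f_X)$ and let $w=x_0^{k_1}x_1x_0^{k_2}x_1\cdots x_0^{k_d}x_1x_0^{k_{d+1}}$ be a word, with $k_i\ge0$. Then $$A\circledast w=A_{(1)}x_0^{k_1}S(A_{(2)})x_1A_{(3)}x_0^{k_2}\cdots x_0^{k_d}S(A_{(2d)})x_1A_{(2d+1)}x_0^{k_{d+1}},$$ using the iterated Sweedler notation $\Delta^{n}(A)=A_{(1)}\otimes\cdots\otimes A_{(n+1)}$ for the coproduct $\Delta$.
   Context: Let $\mathfrak f_X$ be the free Lie algebra over $\mathbb Q$ on $X=\{x_0,x_1\}$ with bracket $[f,g]=fg-gf$. Its universal enveloping algebra is $\mathcal U(\mathfrak f_X)=\mathbb Q\langle X\rangle$ (concatenation product). The coproduct $\Delta$ is the concatenation-multiplicative coproduct with $x_0,x_1$ primitive. The antipode is $S(\varepsilon_1\cdots\varepsilon_n)=(-1)^n\varepsilon_n\cdots\varepsilon_1$. For $f\in\mathfrak f_X$ let $d_f$ be the derivation of $\mathfrak f_X$ with $d_f(x_0)=0$ and $d_f(x_1)=[x_1,f]$, and set $f\triangleright g=d_f(g)$ for $f,g\in\mathfrak f_X$. Extend $\triangleright$ to $\mathcal U(\mathfrak f_X)\times\mathcal U(\mathfrak f_X)\to\mathcal U(\mathfrak f_X)$ as the unique bilinear map satisfying, for $A,B,C\in\mathcal U(\mathfrak f_X)$ and $x,y\in\mathfrak f_X$: - $x\triangleright\mathbf 1=0$; - $\mathbf 1\triangleright A=A$;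 - $xA\triangleright y=x\triangleright(A\triangleright y)-(x\triangleright A)\triangleright y$; - $A\triangleright BC=(A_{(1)}\triangleright B)(A_{(2)}\triangleright C)$, where $\Delta(A)=A_{(1)}\otimes A_{(2)}$. The Grossman–Larson product is $A\circledast B=A_{(1)}(A_{(2)}\triangleright B)$. -}

module Defs where

open import Data.Nat using (ℕ; zero; suc)
open import Data.Rational using (ℚ; 0ℚ; 1ℚ) renaming (_+_ to _+ℚ_; _*_ to _*ℚ_; -_ to -ℚ_)
open import Data.List using (List; []; _∷_; _++_; concatMap; map; reverse; length; replicate)
open import Data.List.Properties using (≡-dec)
open import Data.Vec using (Vec; []; _∷_; updateAt; allFin; toList)
open import Data.Fin using (Fin)
open import Data.Product using (_×_; _,_)
open import Data.Bool using (if_then_else_)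
open import Relation.Nullary using (Dec; yes; no; does)
open import Relation.Binary.PropositionalEquality using (_≡_; refl)

data Letter : Set where
  𝕩₀ 𝕩₁ : Letter

_≟L_ : (a b : Letter) → Dec (a ≡ b)
𝕩₀ ≟L 𝕩₀ = yes refl
𝕩₀ ≟L 𝕩₁ = no λ ()
𝕩₁ ≟L 𝕩₀ = no λ ()
𝕩₁ ≟L 𝕩₁ = yes refl

Word : Set
Word = List Letter

_≟W_ : (u v : Word) → Dec (u ≡ v)
_≟W_ = ≡-dec _≟L_

-- Elements of ℚ⟨X⟩ = U(f_X), represented as formal finite sums Σ cᵢ uᵢ
Poly : Set
Poly = List (ℚ × Word)

coeff : Poly → Word → ℚ
coeff [] w = 0ℚ
coeff ((c , u) ∷ A) w = if does (u ≟W w) then c +ℚ coeff A w else coeff A w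

infix 4 _≈_
_≈_ : Poly → Poly → Set
A ≈ B = ∀ w → coeff A w ≡ coeff B w

word : Word → Poly
word u = (1ℚ , u) ∷ []

𝟘 : Poly
𝟘 = []

𝟙 : Poly
𝟙 = word []

X₀ X₁ : Poly
X₀ = word (𝕩₀ ∷ [])
X₁ = word (𝕩₁ ∷ [])

infixl 6 _⊕_ _⊖_
infixl 7 _⊗_ _·_

_⊕_ : Poly → Poly → Poly
A ⊕ B = A ++ B

_·_ : ℚ → Poly → Poly
c · A = map (λ { (d , u) → (c *ℚ d , u) }) A

_⊖_ : Poly → Poly → Poly
A ⊖ B = A ⊕ (-ℚ 1ℚ) · B

_⊗_ : Poly → Poly → Poly
A ⊗ B = concatMap (λ { (c , u) → map (λ { (d , v) → (c *ℚ d , u ++ v) }) B }) A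

⟦_,_⟧ : Poly → Poly → Poly
⟦ f , g ⟧ = f ⊗ g ⊖ g ⊗ f

signℚ : ℕ → ℚ
signℚ zero = 1ℚ
signℚ (suc n) = -ℚ (signℚ n)

S : Word → Poly
S u = (signℚ (length u) , reverse u) ∷ []

-- Iterated coproduct on a word: Δ^{m-1}(u) = Σ over all ways of distributing
-- the letters of u (keeping order) into m tensor slots.
deal : (m : ℕ) → Word → List (Vec Word m)
deal m [] = Data.Vec.replicate m [] ∷ []
deal m (a ∷ u) =
  concatMap (λ v → toList (Data.Vec.map (λ i → updateAt v i (a ∷_)) (allFin m))) (deal m u)

-- Sweedler sum: sweedler m A f = Σ f(A₍₁₎,…,A₍ₘ₎), for f multilinear, given on words
sweedler : (m : ℕ) → Poly → (Vec Word m → Poly) → Poly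
sweedler m A f = concatMap (λ { (c , u) → concatMap (λ v → c · f v) (deal m u) }) A

data IsLie : Poly → Set where
  lie-x₀ : IsLie X₀
  lie-x₁ : IsLie X₁
  lie-+ : ∀ {f g} → IsLie f → IsLie g → IsLie (f ⊕ g)
  lie-· : ∀ {f} c → IsLie f → IsLie (c · f)
  lie-[] : ∀ {f g} → IsLie f → IsLie g → IsLie ⟦ f , g ⟧
  lie-≈ : ∀ {f g} → IsLie f → f ≈ g → IsLie g

-- The axioms characterising the extended operation ▷ on U(f_X) × U(f_X):
-- bilinear (and well defined on ℚ⟨X⟩), agreeing with f ▷ g = d_f(g) on f_X
-- (d_f the derivation with d_f(x₀)=0, d_f(x₁)=[x₁,f]), and the four rules.
record IsTriangle (_▷_ : Poly → Poly → Poly) : Set where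
  field
    ▷-cong : ∀ {A A′ B B′} → A ≈ A′ → B ≈ B′ → (A ▷ B) ≈ (A′ ▷ B′)
    ▷-+ˡ : ∀ A A′ B → ((A ⊕ A′) ▷ B) ≈ (A ▷ B) ⊕ (A′ ▷ B)
    ▷-+ʳ : ∀ A B B′ → (A ▷ (B ⊕ B′)) ≈ (A ▷ B) ⊕ (A ▷ B′)
    ▷-·ˡ : ∀ c A B → ((c · A) ▷ B) ≈ c · (A ▷ B)
    ▷-·ʳ : ∀ c A B → (A ▷ (c · B)) ≈ c · (A ▷ B)
    ▷-d-x₀ : ∀ f → IsLie f → (f ▷ X₀) ≈ 𝟘
    ▷-d-x₁ : ∀ f → IsLie f → (f ▷ X₁) ≈ ⟦ X₁ , f ⟧
    ▷-d-der : ∀ f g h → IsLie f → IsLie g → IsLie h →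
              (f ▷ ⟦ g , h ⟧) ≈ ⟦ f ▷ g , h ⟧ ⊕ ⟦ g , f ▷ h ⟧
    ▷-unitʳ : ∀ x → IsLie x → (x ▷ 𝟙) ≈ 𝟘
    ▷-unitˡ : ∀ A → (𝟙 ▷ A) ≈ A
    ▷-assoc : ∀ x A y → IsLie x → IsLie y →
              ((x ⊗ A) ▷ y) ≈ (x ▷ (A ▷ y)) ⊖ ((x ▷ A) ▷ y)
    ▷-coprod : ∀ A B C →
              (A ▷ (B ⊗ C)) ≈ sweedler 2 A (λ { (a₁ ∷ a₂ ∷ []) → (word a₁ ▷ B) ⊗ (word a₂ ▷ C) })

-- Grossman–Larson product  A ⊛ B = A₍₁₎ (A₍₂₎ ▷ B)
GL : (Poly → Poly → Poly) → Poly → Poly → Poly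
GL _▷_ A B = sweedler 2 A (λ { (a₁ ∷ a₂ ∷ []) → word a₁ ⊗ (word a₂ ▷ B) })

x₀^ : ℕ → Word
x₀^ k = replicate k 𝕩₀

twice : ℕ → ℕ
twice zero = zero
twice (suc n) = suc (suc (twice n))

wordW : (d : ℕ) → Vec ℕ (suc d) → Word
wordW zero (k ∷ []) = x₀^ k
wordW (suc d) (k ∷ ks) = x₀^ k ++ (𝕩₁ ∷ wordW d ks)

rhsTerm : (d : ℕ) → Vec ℕ (suc d) → Vec Word (suc (twice d)) → Poly
rhsTerm zero (k ∷ []) (a ∷ []) = word (a ++ x₀^ k)
rhsTerm (suc d) (k ∷ ks) (a ∷ b ∷ rest) =
  word (a ++ x₀^ k) ⊗ S b ⊗ X₁ ⊗ rhsTerm d ks rest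

-- Since Lie elements f are primitive (Δ f = f ⊗ 1 + 1 ⊗ f), the coproduct rule makes
-- f ▷ _ a derivation of the concatenation product.  Read as a recursion on the left
-- factor, xA ▷ y = x ▷ (A ▷ y) − (x ▷ A) ▷ y then pins down the action of a word u on
-- the generators: u ▷ x₀ = ε(u) x₀ and u ▷ x₁ = [⋯[x₁, u₁], …, uₙ] = S(u₍₁₎) x₁ u₍₂₎;
-- the coproduct rule alone gives u ▷ 1 = ε(u) 1.  For w = x₀^k x₁ w′ the coproduct
-- rule gives u ▷ w = x₀^k Σ (u₍₁₎ ▷ x₁)(u₍₂₎ ▷ w′), and coassociativity of Δ together
-- with induction on the number of letters x₁ in w yields the formula.

module Submission where

open import Defs
open import Data.Nat using (ℕ; zero; suc; _≤_; _<_; z≤n; s≤s) renaming (_+_ to _+ℕ_)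
import Data.Nat.Properties as ℕₚ
open import Data.Rational using (ℚ; 0ℚ; 1ℚ; _+_; _*_; -_)
import Data.Rational.Properties as ℚₚ
open import Data.Rational.Solver using (module +-*-Solver)
open import Data.List using (List; []; _∷_; _++_; concatMap; map; length; reverse)
import Data.List.Properties as Listₚ
open import Data.List.Relation.Unary.All using (All; []; _∷_)
open import Data.List.Relation.Unary.All.Properties using (concat⁺; gmap⁺)
open import Data.Vec using (Vec; []; _∷_; updateAt; allFin; toList; tabulate)
import Data.Vec as Vec
import Data.Vec.Properties as Vecₚ
open import Data.Fin as Fin using (Fin)
open import Data.Product using (_×_; _,_; proj₁; proj₂)
open import Data.Bool using (true; false; if_then_else_)
open import Data.Empty using (⊥-elim)
open import Function using (_∘_)
open import Relation.Nullary using (Dec; yes; no; does; ¬_)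
open import Relation.Binary.PropositionalEquality
open import Relation.Binary.Bundles using (Setoid)
import Relation.Binary.Reasoning.Setoid as SetoidReasoning

open +-*-Solver hiding (⟦_⟧)

x≡x+x⇒x≡0 : ∀ {x : ℚ} → x ≡ x + x → x ≡ 0ℚ
x≡x+x⇒x≡0 {x} x≡2x = trans (solve 1 (λ x → x := (x :+ x) :+ (:- con 1ℚ) :* x) refl x)
  (trans (cong (λ z → z + (- 1ℚ) * x) (sym x≡2x)) (solve 1 (λ x → x :+ (:- con 1ℚ) :* x := con 0ℚ) refl x))

coeff-⊕ : ∀ A B w → coeff (A ⊕ B) w ≡ coeff A w + coeff B w
coeff-⊕ [] B w = sym (ℚₚ.+-identityˡ _)
coeff-⊕ ((c , u) ∷ A) B w with does (u ≟W w)
... | true = trans (cong (c +_) (coeff-⊕ A B w)) (sym (ℚₚ.+-assoc c _ _))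
... | false = coeff-⊕ A B w

coeff-· : ∀ c A w → coeff (c · A) w ≡ c * coeff A w
coeff-· c [] w = sym (ℚₚ.*-zeroʳ c)
coeff-· c ((d , u) ∷ A) w with does (u ≟W w)
... | true = trans (cong (c * d +_) (coeff-· c A w)) (sym (ℚₚ.*-distribˡ-+ c d _))
... | false = coeff-· c A w

coeff-⊖ : ∀ A B w → coeff (A ⊖ B) w ≡ coeff A w + (- 1ℚ) * coeff B w
coeff-⊖ A B w = trans (coeff-⊕ A _ w) (cong (coeff A w +_) (coeff-· (- 1ℚ) B w))

-- _≈_ is a Π-type over words, from which Agda cannot recover its two sides;
-- the record wrapper makes them inferable.
infix 4 _≋_
record _≋_ (A B : Poly) : Set where
  constructor mk≋
  field get : A ≈ B
open _≋_ public

≋-refl : ∀ {A} → A ≋ A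
≋-refl = mk≋ λ w → refl

≋-sym : ∀ {A B} → A ≋ B → B ≋ A
≋-sym p = mk≋ λ w → sym (get p w)

≋-trans : ∀ {A B C} → A ≋ B → B ≋ C → A ≋ C
≋-trans p q = mk≋ λ w → trans (get p w) (get q w)

≡⇒≋ : ∀ {A B} → A ≡ B → A ≋ B
≡⇒≋ refl = ≋-refl

Poly-setoid : Setoid _ _
Poly-setoid = record
  { Carrier = Poly ; _≈_ = _≋_
  ; isEquivalence = record { refl = ≋-refl ; sym = ≋-sym ; trans = ≋-trans } }

module ≋-Reasoning = SetoidReasoning Poly-setoid

⊕-cong : ∀ {A A′ B B′} → A ≋ A′ → B ≋ B′ → (A ⊕ B) ≋ (A′ ⊕ B′)
⊕-cong {A} {A′} {B} {B′} p q = mk≋ λ w →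
  trans (coeff-⊕ A B w) (trans (cong₂ _+_ (get p w) (get q w)) (sym (coeff-⊕ A′ B′ w)))

⊕-congˡ : ∀ {A A′} B → A ≋ A′ → (A ⊕ B) ≋ (A′ ⊕ B)
⊕-congˡ B p = ⊕-cong p ≋-refl

⊕-congʳ : ∀ A {B B′} → B ≋ B′ → (A ⊕ B) ≋ (A ⊕ B′)
⊕-congʳ A p = ⊕-cong ≋-refl p

·-cong : ∀ c {A B} → A ≋ B → (c · A) ≋ (c · B)
·-cong c {A} {B} p = mk≋ λ w →
  trans (coeff-· c A w) (trans (cong (c *_) (get p w)) (sym (coeff-· c B w)))

·-congˡ : ∀ {c d} A → c ≡ d → (c · A) ≋ (d · A)
·-congˡ A refl = ≋-refl

⊖-cong : ∀ {A A′ B B′} → A ≋ A′ → B ≋ B′ → (A ⊖ B) ≋ (A′ ⊖ B′)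
⊖-cong p q = ⊕-cong p (·-cong (- 1ℚ) q)

⊕-comm : ∀ A B → (A ⊕ B) ≋ (B ⊕ A)
⊕-comm A B = mk≋ λ w →
  trans (coeff-⊕ A B w) (trans (ℚₚ.+-comm (coeff A w) (coeff B w)) (sym (coeff-⊕ B A w)))

⊕-assoc : ∀ A B C → ((A ⊕ B) ⊕ C) ≋ (A ⊕ (B ⊕ C))
⊕-assoc A B C = ≡⇒≋ (Listₚ.++-assoc A B C)

⊕-identityʳ : ∀ A → (A ⊕ 𝟘) ≋ A
⊕-identityʳ A = ≡⇒≋ (Listₚ.++-identityʳ A)

·-⊕ : ∀ c A B → (c · (A ⊕ B)) ≋ (c · A ⊕ c · B)
·-⊕ c A B = ≡⇒≋ (Listₚ.map-++ _ A B)

·-· : ∀ c d A → (c · (d · A)) ≋ ((c * d) · A)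
·-· c d A = mk≋ λ w →
  trans (coeff-· c (d · A) w) (trans (cong (c *_) (coeff-· d A w))
  (trans (sym (ℚₚ.*-assoc c d _)) (sym (coeff-· (c * d) A w))))

·-identityˡ : ∀ A → (1ℚ · A) ≋ A
·-identityˡ A = mk≋ λ w → trans (coeff-· 1ℚ A w) (ℚₚ.*-identityˡ (coeff A w))

·-zeroˡ : ∀ A → (0ℚ · A) ≋ 𝟘
·-zeroˡ A = mk≋ λ w → trans (coeff-· 0ℚ A w) (ℚₚ.*-zeroˡ (coeff A w))

⊖-self : ∀ A → (A ⊖ A) ≋ 𝟘
⊖-self A = mk≋ λ w → trans (coeff-⊖ A A w)
  (solve 1 (λ x → x :+ (:- con 1ℚ) :* x := con 0ℚ) refl (coeff A w))

⊕-⊖-cancel : ∀ A B → ((A ⊕ B) ⊖ B) ≋ A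
⊕-⊖-cancel A B = mk≋ λ w →
  trans (coeff-⊖ (A ⊕ B) B w) (trans (cong (_+ (- 1ℚ) * coeff B w) (coeff-⊕ A B w))
  (solve 2 (λ a b → a :+ b :+ (:- con 1ℚ) :* b := a) refl (coeff A w) (coeff B w)))

⊖-⊕-cancel : ∀ A B → ((A ⊖ B) ⊕ B) ≋ A
⊖-⊕-cancel A B = mk≋ λ w →
  trans (coeff-⊕ (A ⊖ B) B w) (trans (cong (_+ coeff B w) (coeff-⊖ A B w))
  (solve 2 (λ a b → a :+ (:- con 1ℚ) :* b :+ b := a) refl (coeff A w) (coeff B w)))

⊖-cancel-common : ∀ A B C C′ → C ≋ C′ → ((A ⊕ C) ⊖ (B ⊕ C′)) ≋ (A ⊖ B)
⊖-cancel-common A B C C′ p = mk≋ λ w →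
  trans (coeff-⊖ (A ⊕ C) (B ⊕ C′) w)
  (trans (cong₂ (λ x y → x + (- 1ℚ) * y) (coeff-⊕ A C w)
                (trans (coeff-⊕ B C′ w) (cong (coeff B w +_) (sym (get p w)))))
  (trans (solve 3 (λ a b c → a :+ c :+ (:- con 1ℚ) :* (b :+ c) := a :+ (:- con 1ℚ) :* b) refl
                  (coeff A w) (coeff B w) (coeff C w))
  (sym (coeff-⊖ A B w))))

⊕-interchange : ∀ A B C D → ((A ⊕ B) ⊕ (C ⊕ D)) ≋ ((A ⊕ C) ⊕ (B ⊕ D))
⊕-interchange A B C D = mk≋ λ w →
  trans (coeff-⊕ (A ⊕ B) (C ⊕ D) w) (trans (cong₂ _+_ (coeff-⊕ A B w) (coeff-⊕ C D w))
  (trans (solve 4 (λ a b c d → (a :+ b) :+ (c :+ d) := (a :+ c) :+ (b :+ d)) refl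
                  (coeff A w) (coeff B w) (coeff C w) (coeff D w))
  (sym (trans (coeff-⊕ (A ⊕ C) (B ⊕ D) w) (cong₂ _+_ (coeff-⊕ A C w) (coeff-⊕ B D w))))))

⊕-interchange′ : ∀ A B C D → ((A ⊕ B) ⊕ (C ⊕ D)) ≋ ((A ⊕ D) ⊕ (B ⊕ C))
⊕-interchange′ A B C D = ≋-trans (⊕-congʳ (A ⊕ B) (⊕-comm C D)) (⊕-interchange A B D C)

∑ : {I : Set} → List I → (I → Poly) → Poly
∑ xs f = concatMap f xs

∑-++ : {I : Set} (xs ys : List I) (f : I → Poly) → ∑ (xs ++ ys) f ≡ ∑ xs f ⊕ ∑ ys f
∑-++ [] ys f = refl
∑-++ (x ∷ xs) ys f = trans (cong (f x ++_) (∑-++ xs ys f)) (sym (Listₚ.++-assoc (f x) _ _))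

∑-cong : {I : Set} (xs : List I) {f g : I → Poly} → (∀ x → f x ≋ g x) → ∑ xs f ≋ ∑ xs g
∑-cong [] p = ≋-refl
∑-cong (x ∷ xs) p = ⊕-cong (p x) (∑-cong xs p)

∑-cong-All : {I : Set} {P : I → Set} (xs : List I) {f g : I → Poly} →
  All P xs → (∀ x → P x → f x ≋ g x) → ∑ xs f ≋ ∑ xs g
∑-cong-All [] [] p = ≋-refl
∑-cong-All (x ∷ xs) (px ∷ pxs) p = ⊕-cong (p x px) (∑-cong-All xs pxs p)

∑-⊕ : {I : Set} (xs : List I) (f g : I → Poly) → ∑ xs (λ x → f x ⊕ g x) ≋ (∑ xs f ⊕ ∑ xs g)
∑-⊕ [] f g = ≋-refl
∑-⊕ (x ∷ xs) f g = ≋-trans (⊕-congʳ (f x ⊕ g x) (∑-⊕ xs f g)) (⊕-interchange (f x) (g x) _ _)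

∑-· : {I : Set} (xs : List I) (c : ℚ) (f : I → Poly) → ∑ xs (λ x → c · f x) ≋ (c · ∑ xs f)
∑-· [] c f = ≋-refl
∑-· (x ∷ xs) c f = ≋-trans (⊕-congʳ (c · f x) (∑-· xs c f)) (≋-sym (·-⊕ c (f x) _))

∑-𝟘 : {I : Set} (xs : List I) → ∑ xs (λ _ → 𝟘) ≋ 𝟘
∑-𝟘 [] = ≋-refl
∑-𝟘 (x ∷ xs) = ∑-𝟘 xs

∑-map : {I J : Set} (h : I → J) (xs : List I) (f : J → Poly) → ∑ (map h xs) f ≡ ∑ xs (f ∘ h)
∑-map h [] f = refl
∑-map h (x ∷ xs) f = cong (f (h x) ++_) (∑-map h xs f)

∑-concatMap : {I J : Set} (h : I → List J) (xs : List I) (f : J → Poly) →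
  ∑ (concatMap h xs) f ≋ ∑ xs (λ x → ∑ (h x) f)
∑-concatMap h [] f = ≋-refl
∑-concatMap h (x ∷ xs) f =
  ≋-trans (≡⇒≋ (∑-++ (h x) (concatMap h xs) f)) (⊕-congʳ _ (∑-concatMap h xs f))

∑-swap : {I J : Set} (xs : List I) (ys : List J) (f : I → J → Poly) →
  ∑ xs (λ x → ∑ ys (λ y → f x y)) ≋ ∑ ys (λ y → ∑ xs (λ x → f x y))
∑-swap [] ys f = ≋-sym (∑-𝟘 ys)
∑-swap (x ∷ xs) ys f =
  ≋-trans (⊕-congʳ _ (∑-swap xs ys f)) (≋-sym (∑-⊕ ys (f x) (λ y → ∑ xs (λ x → f x y))))

term : (Word → Poly) → ℚ × Word → Poly
term F (c , u) = c · F u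

bind : Poly → (Word → Poly) → Poly
bind A F = ∑ A (term F)

pairing : Poly → (Word → ℚ) → ℚ
pairing [] g = 0ℚ
pairing ((c , u) ∷ A) g = c * g u + pairing A g

coeff-bind : ∀ A F w → coeff (bind A F) w ≡ pairing A (λ u → coeff (F u) w)
coeff-bind [] F w = refl
coeff-bind ((c , u) ∷ A) F w =
  trans (coeff-⊕ (c · F u) (bind A F) w) (cong₂ _+_ (coeff-· c (F u) w) (coeff-bind A F w))

pairing-++ : ∀ A B g → pairing (A ++ B) g ≡ pairing A g + pairing B g
pairing-++ [] B g = sym (ℚₚ.+-identityˡ _)
pairing-++ ((c , u) ∷ A) B g =
  trans (cong (c * g u +_) (pairing-++ A B g)) (sym (ℚₚ.+-assoc (c * g u) _ _))

pairing-· : ∀ k A g → pairing (k · A) g ≡ k * pairing A g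
pairing-· k [] g = sym (ℚₚ.*-zeroʳ k)
pairing-· k ((c , u) ∷ A) g = trans (cong (k * c * g u +_) (pairing-· k A g))
  (solve 4 (λ k c x p → k :* c :* x :+ k :* p := k :* (c :* x :+ p)) refl k c (g u) (pairing A g))

≟W-refl : ∀ u → does (u ≟W u) ≡ true
≟W-refl u with u ≟W u
... | yes _ = refl
... | no ¬p = ⊥-elim (¬p refl)

dropWord : Word → Poly → Poly
dropWord u [] = []
dropWord u ((c , v) ∷ Z) = if does (v ≟W u) then dropWord u Z else (c , v) ∷ dropWord u Z

dropWord-length : ∀ u Z → length (dropWord u Z) ≤ length Z
dropWord-length u [] = z≤n
dropWord-length u ((c , v) ∷ Z) with does (v ≟W u)
... | true = ℕₚ.m≤n⇒m≤1+n (dropWord-length u Z)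
... | false = s≤s (dropWord-length u Z)

pairing-dropWord : ∀ u Z g → pairing Z g ≡ coeff Z u * g u + pairing (dropWord u Z) g
pairing-dropWord u [] g = solve 1 (λ x → con 0ℚ := con 0ℚ :* x :+ con 0ℚ) refl (g u)
pairing-dropWord u ((c , v) ∷ Z) g with v ≟W u
... | yes refl = trans (cong (c * g v +_) (pairing-dropWord v Z g))
      (solve 4 (λ c x y z → c :* x :+ (y :* x :+ z) := (c :+ y) :* x :+ z) refl
        c (g v) (coeff Z v) (pairing (dropWord v Z) g))
... | no _ = trans (cong (c * g v +_) (pairing-dropWord u Z g))
      (solve 5 (λ c x y z p → c :* x :+ (y :* z :+ p) := y :* z :+ (c :* x :+ p)) refl
        c (g v) (coeff Z u) (g u) (pairing (dropWord u Z) g))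

coeff-dropWord-self : ∀ u Z → coeff (dropWord u Z) u ≡ 0ℚ
coeff-dropWord-self u [] = refl
coeff-dropWord-self u ((c , v) ∷ Z) with v ≟W u
... | yes refl = coeff-dropWord-self v Z
... | no v≢u with v ≟W u
...   | yes v≡u = ⊥-elim (v≢u v≡u)
...   | no _ = coeff-dropWord-self u Z

coeff-dropWord-other : ∀ u Z w → ¬ (u ≡ w) → coeff (dropWord u Z) w ≡ coeff Z w
coeff-dropWord-other u [] w u≢w = refl
coeff-dropWord-other u ((c , v) ∷ Z) w u≢w with v ≟W u
... | yes refl with v ≟W w
...   | yes refl = ⊥-elim (u≢w refl)
...   | no _ = coeff-dropWord-other v Z w u≢w
coeff-dropWord-other u ((c , v) ∷ Z) w u≢w | no _ with v ≟W w
... | yes refl = cong (c +_) (coeff-dropWord-other u Z v u≢w)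
... | no _ = coeff-dropWord-other u Z w u≢w

dropWord-≋𝟘 : ∀ u Z → Z ≋ 𝟘 → dropWord u Z ≋ 𝟘
dropWord-≋𝟘 u Z p = mk≋ λ w → coeff-dropWord w (u ≟W w)
  where
  coeff-dropWord : ∀ w → Dec (u ≡ w) → coeff (dropWord u Z) w ≡ 0ℚ
  coeff-dropWord w (yes refl) = coeff-dropWord-self u Z
  coeff-dropWord w (no u≢w) = trans (coeff-dropWord-other u Z w u≢w) (get p w)

dropWord-head : ∀ c u Z → dropWord u ((c , u) ∷ Z) ≡ dropWord u Z
dropWord-head c u Z rewrite ≟W-refl u = refl

-- A representative of 𝟘 may contain cancelling terms; removing all terms on
-- one word at a time (which together have coefficient 0) terminates on length.
pairing-≋𝟘 : ∀ n Z g → length Z ≤ n → Z ≋ 𝟘 → pairing Z g ≡ 0ℚ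
pairing-≋𝟘 n [] g _ _ = refl
pairing-≋𝟘 (suc n) ((c , u) ∷ Z) g (s≤s |Z|≤n) p = begin
  pairing Z′ g                                    ≡⟨ pairing-dropWord u Z′ g ⟩
  coeff Z′ u * g u + pairing (dropWord u Z′) g    ≡⟨ cong₂ (λ a b → a * g u + b) (get p u) rest≡0 ⟩
  0ℚ * g u + 0ℚ                                   ≡⟨ solve 1 (λ x → con 0ℚ :* x :+ con 0ℚ := con 0ℚ) refl (g u) ⟩
  0ℚ                                              ∎
  where
  open ≡-Reasoning
  Z′ = (c , u) ∷ Z
  rest≡0 : pairing (dropWord u Z′) g ≡ 0ℚ
  rest≡0 = subst (λ Y → pairing Y g ≡ 0ℚ) (sym (dropWord-head c u Z))
    (pairing-≋𝟘 n (dropWord u Z) g (ℕₚ.≤-trans (dropWord-length u Z) |Z|≤n)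
      (subst (_≋ 𝟘) (dropWord-head c u Z) (dropWord-≋𝟘 u Z′ p)))

pairing-cong : ∀ {A B} g → A ≋ B → pairing A g ≡ pairing B g
pairing-cong {A} {B} g A≋B = begin
  pairing A g
    ≡⟨ solve 2 (λ a b → a := (a :+ (:- con 1ℚ) :* b) :+ b) refl (pairing A g) (pairing B g) ⟩
  (pairing A g + (- 1ℚ) * pairing B g) + pairing B g
    ≡⟨ cong (_+ pairing B g) pairing-A⊖B ⟩
  0ℚ + pairing B g
    ≡⟨ ℚₚ.+-identityˡ _ ⟩
  pairing B g
    ∎
  where
  open ≡-Reasoning
  pairing-A⊖B : pairing A g + (- 1ℚ) * pairing B g ≡ 0ℚ
  pairing-A⊖B = trans (cong (pairing A g +_) (sym (pairing-· (- 1ℚ) B g)))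
    (trans (sym (pairing-++ A _ g))
    (pairing-≋𝟘 _ (A ⊖ B) g ℕₚ.≤-refl (≋-trans (⊖-cong A≋B ≋-refl) (⊖-self B))))

record IsLinear (Φ : Poly → Poly) : Set where
  field
    lin-cong : ∀ {A B} → A ≋ B → Φ A ≋ Φ B
    lin-⊕ : ∀ A B → Φ (A ⊕ B) ≋ (Φ A ⊕ Φ B)
    lin-· : ∀ c A → Φ (c · A) ≋ (c · Φ A)
open IsLinear public

lin-𝟘 : ∀ {Φ} → IsLinear Φ → Φ 𝟘 ≋ 𝟘
lin-𝟘 lΦ = ≋-trans (lin-· lΦ 0ℚ 𝟘) (·-zeroˡ _)

lin-⊖ : ∀ {Φ} → IsLinear Φ → ∀ A B → Φ (A ⊖ B) ≋ (Φ A ⊖ Φ B)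
lin-⊖ lΦ A B = ≋-trans (lin-⊕ lΦ A _) (⊕-congʳ _ (lin-· lΦ (- 1ℚ) B))

lin-∑ : ∀ {Φ} → IsLinear Φ → {I : Set} (xs : List I) (f : I → Poly) → Φ (∑ xs f) ≋ ∑ xs (Φ ∘ f)
lin-∑ lΦ [] f = lin-𝟘 lΦ
lin-∑ lΦ (x ∷ xs) f = ≋-trans (lin-⊕ lΦ (f x) _) (⊕-congʳ _ (lin-∑ lΦ xs f))

lin-bind : ∀ {Φ} → IsLinear Φ → ∀ A F → Φ (bind A F) ≋ bind A (Φ ∘ F)
lin-bind lΦ A F = ≋-trans (lin-∑ lΦ A (term F)) (∑-cong A (λ { (c , u) → lin-· lΦ c (F u) }))

linear-id : IsLinear (λ A → A)
linear-id = record { lin-cong = λ p → p ; lin-⊕ = λ A B → ≋-refl ; lin-· = λ c A → ≋-refl }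

linear-∘ : ∀ {Φ Ψ} → IsLinear Φ → IsLinear Ψ → IsLinear (Φ ∘ Ψ)
linear-∘ lΦ lΨ = record
  { lin-cong = λ p → lin-cong lΦ (lin-cong lΨ p)
  ; lin-⊕ = λ A B → ≋-trans (lin-cong lΦ (lin-⊕ lΨ A B)) (lin-⊕ lΦ _ _)
  ; lin-· = λ c A → ≋-trans (lin-cong lΦ (lin-· lΨ c A)) (lin-· lΦ c _) }

linear-⊕ : ∀ {Φ Ψ} → IsLinear Φ → IsLinear Ψ → IsLinear (λ A → Φ A ⊕ Ψ A)
linear-⊕ {Φ} {Ψ} lΦ lΨ = record
  { lin-cong = λ p → ⊕-cong (lin-cong lΦ p) (lin-cong lΨ p)
  ; lin-⊕ = λ A B → ≋-trans (⊕-cong (lin-⊕ lΦ A B) (lin-⊕ lΨ A B)) (⊕-interchange (Φ A) (Φ B) (Ψ A) (Ψ B))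
  ; lin-· = λ c A → ≋-trans (⊕-cong (lin-· lΦ c A) (lin-· lΨ c A)) (≋-sym (·-⊕ c (Φ A) (Ψ A))) }

linear-· : ∀ {Φ} k → IsLinear Φ → IsLinear (λ A → k · Φ A)
linear-· {Φ} k lΦ = record
  { lin-cong = λ p → ·-cong k (lin-cong lΦ p)
  ; lin-⊕ = λ A B → ≋-trans (·-cong k (lin-⊕ lΦ A B)) (·-⊕ k (Φ A) (Φ B))
  ; lin-· = λ c A → ≋-trans (·-cong k (lin-· lΦ c A))
      (≋-trans (·-· k c (Φ A)) (≋-trans (·-congˡ (Φ A) (ℚₚ.*-comm k c)) (≋-sym (·-· c k (Φ A))))) }

linear-⊖ : ∀ {Φ Ψ} → IsLinear Φ → IsLinear Ψ → IsLinear (λ A → Φ A ⊖ Ψ A)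
linear-⊖ lΦ lΨ = linear-⊕ lΦ (linear-· (- 1ℚ) lΨ)

bind-congˡ : ∀ {A B} F → A ≋ B → bind A F ≋ bind B F
bind-congˡ {A} {B} F p = mk≋ λ w →
  trans (coeff-bind A F w) (trans (pairing-cong _ p) (sym (coeff-bind B F w)))

bind-congʳ : ∀ A {F G} → (∀ u → F u ≋ G u) → bind A F ≋ bind A G
bind-congʳ A p = ∑-cong A (λ { (c , u) → ·-cong c (p u) })

bind-linearˡ : ∀ F → IsLinear (λ A → bind A F)
bind-linearˡ F = record
  { lin-cong = bind-congˡ F
  ; lin-⊕ = λ A B → ≡⇒≋ (∑-++ A B (term F))
  ; lin-· = λ c A → ≋-trans (≡⇒≋ (∑-map _ A (term F)))
      (≋-trans (∑-cong A (λ { (d , u) → ≋-sym (·-· c d (F u)) })) (∑-· A c (term F))) }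

bind-⊕ʳ : ∀ A F G → bind A (λ u → F u ⊕ G u) ≋ (bind A F ⊕ bind A G)
bind-⊕ʳ A F G = ≋-trans (∑-cong A (λ { (c , u) → ·-⊕ c (F u) (G u) })) (∑-⊕ A (term F) (term G))

bind-·ʳ : ∀ A c F → bind A (λ u → c · F u) ≋ (c · bind A F)
bind-·ʳ A c F = ≋-trans (∑-cong A scalars-commute) (∑-· A c (term F))
  where
  scalars-commute : ∀ t → term (λ u → c · F u) t ≋ c · term F t
  scalars-commute (d , u) = ≋-trans (·-· d c (F u))
    (≋-trans (·-congˡ (F u) (ℚₚ.*-comm d c)) (≋-sym (·-· c d (F u))))

bind-𝟘ʳ : ∀ A → bind A (λ _ → 𝟘) ≋ 𝟘
bind-𝟘ʳ A = ∑-𝟘 A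

bind-linearʳ : ∀ A (Ψ : Word → Poly → Poly) → (∀ u → IsLinear (Ψ u)) →
  IsLinear (λ B → bind A (λ u → Ψ u B))
bind-linearʳ A Ψ lΨ = record
  { lin-cong = λ p → bind-congʳ A (λ u → lin-cong (lΨ u) p)
  ; lin-⊕ = λ B C → ≋-trans (bind-congʳ A (λ u → lin-⊕ (lΨ u) B C)) (bind-⊕ʳ A (λ u → Ψ u B) (λ u → Ψ u C))
  ; lin-· = λ c B → ≋-trans (bind-congʳ A (λ u → lin-· (lΨ u) c B)) (bind-·ʳ A c (λ u → Ψ u B)) }

bind-word : ∀ u F → bind (word u) F ≋ F u
bind-word u F = ≋-trans (⊕-identityʳ _) (·-identityˡ (F u))

single-cong : ∀ {c d} u → c ≡ d → ((c , u) ∷ []) ≋ ((d , u) ∷ [])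
single-cong u refl = ≋-refl

bind-word-unit : ∀ A → bind A word ≋ A
bind-word-unit [] = ≋-refl
bind-word-unit ((c , u) ∷ A) =
  ⊕-cong {B = bind A word} (single-cong u (ℚₚ.*-identityʳ c)) (bind-word-unit A)

bind-∑ : ∀ A {I : Set} (xs : List I) (H : Word → I → Poly) →
  bind A (λ u → ∑ xs (λ x → H u x)) ≋ ∑ xs (λ x → bind A (λ u → H u x))
bind-∑ A xs H = ≋-trans (∑-cong A (λ { (c , u) → ≋-sym (∑-· xs c (H u)) }))
  (∑-swap A xs (λ { (c , u) x → c · H u x }))

bind-swap : ∀ A B (H : Word → Word → Poly) →
  bind A (λ u → bind B (λ v → H u v)) ≋ bind B (λ v → bind A (λ u → H u v))
bind-swap A B H = ≋-trans (bind-∑ A B (λ { u (d , v) → d · H u v }))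
  (∑-cong B (λ { (d , v) → bind-·ʳ A d (λ u → H u v) }))

bind-assoc : ∀ A F G → bind (bind A F) G ≋ bind A (λ u → bind (F u) G)
bind-assoc A F G = lin-bind (bind-linearˡ G) A F

linear-as-bind : ∀ {Φ} → IsLinear Φ → ∀ A → Φ A ≋ bind A (λ u → Φ (word u))
linear-as-bind lΦ A = ≋-trans (lin-cong lΦ (≋-sym (bind-word-unit A))) (lin-bind lΦ A word)

bind-form⇒linear : ∀ {Φ} G → (∀ A → Φ A ≋ bind A G) → IsLinear Φ
bind-form⇒linear {Φ} G r = record
  { lin-cong = λ {A} {B} p → ≋-trans (r A) (≋-trans (bind-congˡ G p) (≋-sym (r B)))
  ; lin-⊕ = λ A B → ≋-trans (r (A ⊕ B)) (≋-trans (lin-⊕ (bind-linearˡ G) A B) (⊕-cong (≋-sym (r A)) (≋-sym (r B))))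
  ; lin-· = λ c A → ≋-trans (r (c · A)) (≋-trans (lin-· (bind-linearˡ G) c A) (·-cong c (≋-sym (r A)))) }

sweedler-bind : ∀ m A f → sweedler m A f ≋ bind A (λ u → ∑ (deal m u) f)
sweedler-bind m [] f = ≋-refl
sweedler-bind m ((c , u) ∷ A) f = ⊕-cong (∑-· (deal m u) c f) (sweedler-bind m A f)

wordMul : Word → Poly → Poly
wordMul u B = bind B (λ v → word (u ++ v))

wordMul-linear : ∀ u → IsLinear (wordMul u)
wordMul-linear u = bind-linearˡ (λ v → word (u ++ v))

⊗-as-bind : ∀ A B → (A ⊗ B) ≋ bind A (λ u → wordMul u B)
⊗-as-bind [] B = ≋-refl
⊗-as-bind ((c , u) ∷ A) B = ⊕-cong (map-as-wordMul B) (⊗-as-bind A B)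
  where
  map-as-wordMul : ∀ B → map (λ { (d , v) → (c * d , u ++ v) }) B ≋ (c · wordMul u B)
  map-as-wordMul [] = ≋-refl
  map-as-wordMul ((d , v) ∷ B) =
    ⊕-cong {A = (c * d , u ++ v) ∷ []} (single-cong (u ++ v) (cong (c *_) (sym (ℚₚ.*-identityʳ d))))
      (map-as-wordMul B)

⊗-linearˡ : ∀ B → IsLinear (_⊗ B)
⊗-linearˡ B = bind-form⇒linear (λ u → wordMul u B) (λ A → ⊗-as-bind A B)

⊗-linearʳ : ∀ A → IsLinear (A ⊗_)
⊗-linearʳ A = record
  { lin-cong = λ {B} {C} p → ≋-trans (⊗-as-bind A B) (≋-trans (lin-cong l p) (≋-sym (⊗-as-bind A C)))
  ; lin-⊕ = λ B C → ≋-trans (⊗-as-bind A _)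
      (≋-trans (lin-⊕ l B C) (⊕-cong (≋-sym (⊗-as-bind A B)) (≋-sym (⊗-as-bind A C))))
  ; lin-· = λ c B → ≋-trans (⊗-as-bind A _) (≋-trans (lin-· l c B) (·-cong c (≋-sym (⊗-as-bind A B)))) }
  where l = bind-linearʳ A wordMul wordMul-linear

⊗-cong : ∀ {A A′ B B′} → A ≋ A′ → B ≋ B′ → (A ⊗ B) ≋ (A′ ⊗ B′)
⊗-cong {A} {A′} {B} {B′} p q = ≋-trans (lin-cong (⊗-linearˡ B) p) (lin-cong (⊗-linearʳ A′) q)

⊗-congˡ : ∀ {A A′} B → A ≋ A′ → (A ⊗ B) ≋ (A′ ⊗ B)
⊗-congˡ B p = ⊗-cong p (≋-refl {B})

⊗-congʳ : ∀ A {B B′} → B ≋ B′ → (A ⊗ B) ≋ (A ⊗ B′)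
⊗-congʳ A p = ⊗-cong (≋-refl {A}) p

⊗-∑ʳ : ∀ A {I : Set} (xs : List I) f → (A ⊗ ∑ xs f) ≋ ∑ xs (λ x → A ⊗ f x)
⊗-∑ʳ A xs f = lin-∑ (⊗-linearʳ A) xs f

bind-⊗ : ∀ A B F → bind (A ⊗ B) F ≋ bind A (λ u → bind B (λ v → F (u ++ v)))
bind-⊗ A B F = ≋-trans (bind-congˡ F (⊗-as-bind A B)) (≋-trans (bind-assoc A (λ u → wordMul u B) F)
  (bind-congʳ A (λ u → ≋-trans (bind-assoc B (λ v → word (u ++ v)) F)
    (bind-congʳ B (λ v → bind-word (u ++ v) F)))))

⊗-assoc : ∀ A B C → ((A ⊗ B) ⊗ C) ≋ (A ⊗ (B ⊗ C))
⊗-assoc A B C = begin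
  (A ⊗ B) ⊗ C
    ≈⟨ ⊗-as-bind (A ⊗ B) C ⟩
  bind (A ⊗ B) (λ t → wordMul t C)
    ≈⟨ bind-⊗ A B (λ t → wordMul t C) ⟩
  bind A (λ u → bind B (λ v → bind C (λ s → word ((u ++ v) ++ s))))
    ≈⟨ bind-congʳ A (λ u → bind-congʳ B (λ v → bind-congʳ C (λ s → ≡⇒≋ (cong word (Listₚ.++-assoc u v s))))) ⟩
  bind A (λ u → bind B (λ v → bind C (λ s → word (u ++ (v ++ s)))))
    ≈⟨ bind-congʳ A (λ u → bind-⊗ B C (λ t → word (u ++ t))) ⟨
  bind A (λ u → wordMul u (B ⊗ C))
    ≈⟨ ⊗-as-bind A (B ⊗ C) ⟨
  A ⊗ (B ⊗ C)
    ∎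
  where open ≋-Reasoning

⊗-identityˡ : ∀ A → (𝟙 ⊗ A) ≋ A
⊗-identityˡ A = ≋-trans (⊗-as-bind 𝟙 A) (≋-trans (bind-word [] (λ u → wordMul u A)) (bind-word-unit A))

⊗-identityʳ : ∀ A → (A ⊗ 𝟙) ≋ A
⊗-identityʳ A = ≋-trans (⊗-as-bind A 𝟙) (≋-trans (bind-congʳ A wordMul-𝟙) (bind-word-unit A))
  where
  wordMul-𝟙 : ∀ u → wordMul u 𝟙 ≋ word u
  wordMul-𝟙 u = ≋-trans (bind-word [] (λ v → word (u ++ v))) (≡⇒≋ (cong word (Listₚ.++-identityʳ u)))

word-⊗-word : ∀ u v → (word u ⊗ word v) ≋ word (u ++ v)
word-⊗-word u v = ≋-trans (⊗-as-bind (word u) (word v))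
  (≋-trans (bind-word u (λ u → wordMul u (word v))) (bind-word v (λ t → word (u ++ t))))

letter : Letter → Poly
letter e = word (e ∷ [])

lie-≋ : ∀ {f g} → IsLie f → f ≋ g → IsLie g
lie-≋ lf f≋g = lie-≈ lf (get f≋g)

letter-lie : ∀ e → IsLie (letter e)
letter-lie 𝕩₀ = lie-x₀
letter-lie 𝕩₁ = lie-x₁

word-∷ : ∀ e v → word (e ∷ v) ≋ (letter e ⊗ word v)
word-∷ e v = ≋-sym (word-⊗-word (e ∷ []) v)

scaled𝟙-⊗ : ∀ c A → ((c · 𝟙) ⊗ A) ≋ (c · A)
scaled𝟙-⊗ c A = ≋-trans (lin-· (⊗-linearˡ A) c 𝟙) (·-cong c (⊗-identityˡ A))

⊗-scaled𝟙 : ∀ c A → (A ⊗ (c · 𝟙)) ≋ (c · A)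
⊗-scaled𝟙 c A = ≋-trans (lin-· (⊗-linearʳ A) c 𝟙) (·-cong c (⊗-identityʳ A))

⟦⟧-linearˡ : ∀ g → IsLinear (λ f → ⟦ f , g ⟧)
⟦⟧-linearˡ g = linear-⊖ (⊗-linearˡ g) (⊗-linearʳ g)

⟦⟧-linearʳ : ∀ f → IsLinear (λ g → ⟦ f , g ⟧)
⟦⟧-linearʳ f = linear-⊖ (⊗-linearʳ f) (⊗-linearˡ f)

⟦⟧-cong : ∀ {A A′ B B′} → A ≋ A′ → B ≋ B′ → ⟦ A , B ⟧ ≋ ⟦ A′ , B′ ⟧
⟦⟧-cong {A} {A′} {B} {B′} p q = ≋-trans (lin-cong (⟦⟧-linearˡ B) p) (lin-cong (⟦⟧-linearʳ A′) q)

⟦⟧-⊗ : ∀ f g Z → (⟦ f , g ⟧ ⊗ Z) ≋ (f ⊗ (g ⊗ Z) ⊖ g ⊗ (f ⊗ Z))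
⟦⟧-⊗ f g Z = ≋-trans (lin-⊖ (⊗-linearˡ Z) (f ⊗ g) (g ⊗ f)) (⊖-cong (⊗-assoc f g Z) (⊗-assoc g f Z))

private
  ⊗₃ : Poly → Poly → Poly → Poly
  ⊗₃ a b c = a ⊗ (b ⊗ c)

  coeff-⊖⊖ : ∀ A B C D w → coeff ((A ⊖ B) ⊖ (C ⊖ D)) w
    ≡ (coeff A w + (- 1ℚ) * coeff B w) + (- 1ℚ) * (coeff C w + (- 1ℚ) * coeff D w)
  coeff-⊖⊖ A B C D w = trans (coeff-⊖ (A ⊖ B) (C ⊖ D) w)
    (cong₂ (λ a b → a + (- 1ℚ) * b) (coeff-⊖ A B w) (coeff-⊖ C D w))

  ⟦⟦⟧⟧-expandˡ : ∀ a b c → ⟦ ⟦ a , b ⟧ , c ⟧ ≋ ((⊗₃ a b c ⊖ ⊗₃ b a c) ⊖ (⊗₃ c a b ⊖ ⊗₃ c b a))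
  ⟦⟦⟧⟧-expandˡ a b c = ⊖-cong (⟦⟧-⊗ a b c) (lin-⊖ (⊗-linearʳ c) (a ⊗ b) (b ⊗ a))

  ⟦⟦⟧⟧-expandʳ : ∀ a b c → ⟦ a , ⟦ b , c ⟧ ⟧ ≋ ((⊗₃ a b c ⊖ ⊗₃ a c b) ⊖ (⊗₃ b c a ⊖ ⊗₃ c b a))
  ⟦⟦⟧⟧-expandʳ a b c = ⊖-cong (lin-⊖ (⊗-linearʳ a) (b ⊗ c) (c ⊗ b)) (⟦⟧-⊗ b c a)

jacobi : ∀ y f g → (⟦ ⟦ y , f ⟧ , g ⟧ ⊖ ⟦ ⟦ y , g ⟧ , f ⟧) ≋ ⟦ y , ⟦ f , g ⟧ ⟧
jacobi y f g = ≋-trans (⊖-cong (⟦⟦⟧⟧-expandˡ y f g) (⟦⟦⟧⟧-expandˡ y g f))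
  (≋-trans (mk≋ expanded) (≋-sym (⟦⟦⟧⟧-expandʳ y f g)))
  where
  yfg fyg gyf gfy ygf fgy : Poly
  yfg = ⊗₃ y f g
  fyg = ⊗₃ f y g
  gyf = ⊗₃ g y f
  gfy = ⊗₃ g f y
  ygf = ⊗₃ y g f
  fgy = ⊗₃ f g y
  expanded : ∀ w → coeff (((yfg ⊖ fyg) ⊖ (gyf ⊖ gfy)) ⊖ ((ygf ⊖ gyf) ⊖ (fyg ⊖ fgy))) w
                   ≡ coeff ((yfg ⊖ ygf) ⊖ (fgy ⊖ gfy)) w
  expanded w =
    trans (coeff-⊖ ((yfg ⊖ fyg) ⊖ (gyf ⊖ gfy)) ((ygf ⊖ gyf) ⊖ (fyg ⊖ fgy)) w)
    (trans (cong₂ (λ a b → a + (- 1ℚ) * b) (coeff-⊖⊖ yfg fyg gyf gfy w) (coeff-⊖⊖ ygf gyf fyg fgy w))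
    (trans (solve 6 (λ yfg fyg gyf gfy ygf fgy →
        ((yfg :+ (:- con 1ℚ) :* fyg) :+ (:- con 1ℚ) :* (gyf :+ (:- con 1ℚ) :* gfy))
          :+ (:- con 1ℚ) :* ((ygf :+ (:- con 1ℚ) :* gyf) :+ (:- con 1ℚ) :* (fyg :+ (:- con 1ℚ) :* fgy))
        := (yfg :+ (:- con 1ℚ) :* ygf) :+ (:- con 1ℚ) :* (fgy :+ (:- con 1ℚ) :* gfy)) refl
        (coeff yfg w) (coeff fyg w) (coeff gyf w) (coeff gfy w) (coeff ygf w) (coeff fgy w))
    (sym (coeff-⊖⊖ yfg ygf fgy gfy w))))

ε : Word → ℚ
ε [] = 1ℚ
ε (_ ∷ _) = 0ℚ

uncurry₂ : (Word → Word → Poly) → Vec Word 2 → Poly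
uncurry₂ g (a ∷ b ∷ []) = g a b

Δ : Word → (Word → Word → Poly) → Poly
Δ u g = ∑ (deal 2 u) (uncurry₂ g)

Δ-cong : ∀ u {g h} → (∀ a b → g a b ≋ h a b) → Δ u g ≋ Δ u h
Δ-cong u p = ∑-cong (deal 2 u) (λ { (a ∷ b ∷ []) → p a b })

Δ-⊕ : ∀ u g h → Δ u (λ a b → g a b ⊕ h a b) ≋ (Δ u g ⊕ Δ u h)
Δ-⊕ u g h = ≋-trans (∑-cong (deal 2 u) (λ { (a ∷ b ∷ []) → ≋-refl })) (∑-⊕ (deal 2 u) (uncurry₂ g) (uncurry₂ h))

lin-Δ : ∀ {Φ} → IsLinear Φ → ∀ u g → Φ (Δ u g) ≋ Δ u (λ a b → Φ (g a b))
lin-Δ lΦ u g = ≋-trans (lin-∑ lΦ (deal 2 u) (uncurry₂ g)) (∑-cong (deal 2 u) (λ { (a ∷ b ∷ []) → ≋-refl }))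

prependSomewhere : (m : ℕ) → Letter → Vec Word m → List (Vec Word m)
prependSomewhere m e v = toList (Vec.map (λ i → updateAt v i (e ∷_)) (allFin m))

deal-∷ : ∀ m e u f → ∑ (deal m (e ∷ u)) f ≋ ∑ (deal m u) (λ v → ∑ (prependSomewhere m e v) f)
deal-∷ m e u f = ∑-concatMap (prependSomewhere m e) (deal m u) f

prependSomewhere-∷ : ∀ m e p (v : Vec Word m) f →
  ∑ (prependSomewhere (suc m) e (p ∷ v)) f ≋ (f ((e ∷ p) ∷ v) ⊕ ∑ (prependSomewhere m e v) (λ v′ → f (p ∷ v′)))
prependSomewhere-∷ m e p v f = ⊕-congʳ (f ((e ∷ p) ∷ v)) (≡⇒≋ (trans
  (cong (λ z → ∑ (toList z) f) (map-tabulate-suc (λ i → updateAt (p ∷ v) i (e ∷_))))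
  (∑-toList-map-∷ (λ i → updateAt v i (e ∷_)) (allFin m))))
  where
  map-tabulate-suc : ∀ {B : Set} (k : Fin (suc m) → B) →
    Vec.map k (tabulate {n = m} Fin.suc) ≡ Vec.map (k ∘ Fin.suc) (allFin m)
  map-tabulate-suc k = trans (sym (Vecₚ.tabulate-∘ k Fin.suc)) (Vecₚ.tabulate-∘ (k ∘ Fin.suc) (λ i → i))
  ∑-toList-map-∷ : ∀ {j} (H : Fin m → Vec Word m) (xs : Vec (Fin m) j) →
    ∑ (toList (Vec.map (λ i → p ∷ H i) xs)) f ≡ ∑ (toList (Vec.map H xs)) (λ v′ → f (p ∷ v′))
  ∑-toList-map-∷ H [] = refl
  ∑-toList-map-∷ H (x ∷ xs) = cong (f (p ∷ H x) ++_) (∑-toList-map-∷ H xs)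

Δ-∷ : ∀ e u g → Δ (e ∷ u) g ≋ Δ u (λ a b → g (e ∷ a) b ⊕ g a (e ∷ b))
Δ-∷ e u g = ≋-trans (deal-∷ 2 e u (uncurry₂ g)) (∑-cong (deal 2 u) prepend-either)
  where
  prepend-either : ∀ v → ∑ (prependSomewhere 2 e v) (uncurry₂ g) ≋ uncurry₂ (λ a b → g (e ∷ a) b ⊕ g a (e ∷ b)) v
  prepend-either (a ∷ b ∷ []) = ⊕-congʳ (g (e ∷ a) b) (⊕-identityʳ (g a (e ∷ b)))

deal-1 : ∀ u f → ∑ (deal 1 u) f ≋ f (u ∷ [])
deal-1 [] f = ⊕-identityʳ _
deal-1 (e ∷ u) f =
  ≋-trans (deal-∷ 1 e u f) (≋-trans (deal-1 u (λ v → ∑ (prependSomewhere 1 e v) f)) (⊕-identityʳ _))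

Δ-counitˡ : ∀ u (F : Word → Poly) → Δ u (λ a b → ε a · F b) ≋ F u
Δ-counitˡ [] F = ≋-trans (⊕-identityʳ _) (·-identityˡ (F []))
Δ-counitˡ (e ∷ u) F = ≋-trans (Δ-∷ e u _)
  (≋-trans (Δ-cong u (λ a b → ⊕-congˡ (ε a · F (e ∷ b)) (·-zeroˡ (F b)))) (Δ-counitˡ u (λ b → F (e ∷ b))))

Δ-counitʳ : ∀ u (F : Word → Poly) → Δ u (λ a b → ε b · F a) ≋ F u
Δ-counitʳ [] F = ≋-trans (⊕-identityʳ _) (·-identityˡ (F []))
Δ-counitʳ (e ∷ u) F = ≋-trans (Δ-∷ e u _)
  (≋-trans (Δ-cong u (λ a b → ≋-trans (⊕-congʳ (ε b · F (e ∷ a)) (·-zeroˡ (F a))) (⊕-identityʳ _)))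
  (Δ-counitʳ u (λ a → F (e ∷ a))))

deal-suc : ∀ m u (f : Vec Word (suc m) → Poly) →
  ∑ (deal (suc m) u) f ≋ Δ u (λ a b → ∑ (deal m b) (λ v → f (a ∷ v)))
deal-suc m [] f = ≋-sym (⊕-identityʳ _)
deal-suc m (e ∷ u) f = begin
  ∑ (deal (suc m) (e ∷ u)) f
    ≈⟨ deal-∷ (suc m) e u f ⟩
  ∑ (deal (suc m) u) (λ v → ∑ (prependSomewhere (suc m) e v) f)
    ≈⟨ deal-suc m u _ ⟩
  Δ u (λ a b → ∑ (deal m b) (λ v → ∑ (prependSomewhere (suc m) e (a ∷ v)) f))
    ≈⟨ Δ-cong u (λ a b → ≋-trans (∑-cong (deal m b) (λ v → prependSomewhere-∷ m e a v f))
                           (∑-⊕ (deal m b) _ _)) ⟩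
  Δ u (λ a b → ∑ (deal m b) (λ v → f ((e ∷ a) ∷ v))
             ⊕ ∑ (deal m b) (λ v → ∑ (prependSomewhere m e v) (λ v′ → f (a ∷ v′))))
    ≈⟨ Δ-cong u (λ a b → ⊕-congʳ _ (deal-∷ m e b (λ v → f (a ∷ v)))) ⟨
  Δ u (λ a b → ∑ (deal m b) (λ v → f ((e ∷ a) ∷ v)) ⊕ ∑ (deal m (e ∷ b)) (λ v → f (a ∷ v)))
    ≈⟨ Δ-∷ e u (λ a b → ∑ (deal m b) (λ v → f (a ∷ v))) ⟨
  Δ (e ∷ u) (λ a b → ∑ (deal m b) (λ v → f (a ∷ v)))
    ∎
  where open ≋-Reasoning

Δ-++ : ∀ u v g → Δ (u ++ v) g ≋ Δ u (λ a₁ a₂ → Δ v (λ b₁ b₂ → g (a₁ ++ b₁) (a₂ ++ b₂)))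
Δ-++ [] v g = ≋-sym (⊕-identityʳ _)
Δ-++ (e ∷ u) v g = begin
  Δ (e ∷ u ++ v) g
    ≈⟨ Δ-∷ e (u ++ v) g ⟩
  Δ (u ++ v) (λ a b → g (e ∷ a) b ⊕ g a (e ∷ b))
    ≈⟨ Δ-++ u v _ ⟩
  Δ u (λ a₁ a₂ → Δ v (λ b₁ b₂ → g (e ∷ a₁ ++ b₁) (a₂ ++ b₂) ⊕ g (a₁ ++ b₁) (e ∷ a₂ ++ b₂)))
    ≈⟨ Δ-cong u (λ a₁ a₂ → Δ-⊕ v _ _) ⟩
  Δ u (λ a₁ a₂ → Δ v (λ b₁ b₂ → g (e ∷ a₁ ++ b₁) (a₂ ++ b₂)) ⊕ Δ v (λ b₁ b₂ → g (a₁ ++ b₁) (e ∷ a₂ ++ b₂)))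
    ≈⟨ Δ-∷ e u (λ a₁ a₂ → Δ v (λ b₁ b₂ → g (a₁ ++ b₁) (a₂ ++ b₂))) ⟨
  Δ (e ∷ u) (λ a₁ a₂ → Δ v (λ b₁ b₂ → g (a₁ ++ b₁) (a₂ ++ b₂)))
    ∎
  where open ≋-Reasoning

Δ-coassoc : ∀ u (H : Word → Word → Word → Poly) →
  Δ u (λ b q → Δ b (λ a p → H a p q)) ≋ Δ u (λ a r → Δ r (λ p q → H a p q))
Δ-coassoc [] H = ≋-refl
Δ-coassoc (e ∷ u) H = begin
  Δ (e ∷ u) K
    ≈⟨ Δ-∷ e u K ⟩
  Δ u (λ b q → K (e ∷ b) q ⊕ K b (e ∷ q))
    ≈⟨ Δ-cong u (λ b q → ≋-trans (⊕-congˡ (K b (e ∷ q)) (Δ-∷ e b (λ a p → H a p q))) (≋-sym (Δ-⊕ b _ _))) ⟩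
  Δ u (λ b q → Δ b (λ a p → H′ a p q))
    ≈⟨ Δ-coassoc u H′ ⟩
  Δ u (λ a r → Δ r (λ p q → H′ a p q))
    ≈⟨ Δ-cong u (λ a r → ≋-trans (Δ-cong r (λ p q → ⊕-assoc (H (e ∷ a) p q) _ _)) (≋-trans (Δ-⊕ r _ _)
         (⊕-congʳ (M (e ∷ a) r) (≋-sym (Δ-∷ e r (λ p q → H a p q)))))) ⟩
  Δ u (λ a r → M (e ∷ a) r ⊕ M a (e ∷ r))
    ≈⟨ Δ-∷ e u M ⟨
  Δ (e ∷ u) M
    ∎
  where
  open ≋-Reasoning
  K M : Word → Word → Poly
  K b q = Δ b (λ a p → H a p q)
  M a r = Δ r (λ p q → H a p q)
  H′ : Word → Word → Word → Poly
  H′ a p q = (H (e ∷ a) p q ⊕ H a (e ∷ p) q) ⊕ H a p (e ∷ q)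

SplitsLength : Word → Vec Word 2 → Set
SplitsLength u (a ∷ b ∷ []) = length a +ℕ length b ≡ length u

deal2-lengths : ∀ u → All (SplitsLength u) (deal 2 u)
deal2-lengths [] = refl ∷ []
deal2-lengths (e ∷ u) = concat⁺ (gmap⁺ prepend-lengths (deal2-lengths u))
  where
  prepend-lengths : ∀ {v} → SplitsLength u v → All (SplitsLength (e ∷ u)) (prependSomewhere 2 e v)
  prepend-lengths {a ∷ b ∷ []} p = cong suc p ∷ trans (ℕₚ.+-suc (length a) (length b)) (cong suc p) ∷ []

adʳ : Word → Poly → Poly
adʳ [] y = y
adʳ (e ∷ v) y = adʳ v ⟦ y , letter e ⟧

adʳ-linear : ∀ v → IsLinear (adʳ v)
adʳ-linear [] = linear-id
adʳ-linear (e ∷ v) = linear-∘ (adʳ-linear v) (⟦⟧-linearˡ (letter e))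

adʳ-++ : ∀ u v y → adʳ (u ++ v) y ≡ adʳ v (adʳ u y)
adʳ-++ [] v y = refl
adʳ-++ (e ∷ u) v y = adʳ-++ u v ⟦ y , letter e ⟧

Ad : Poly → Poly → Poly
Ad A y = bind A (λ v → adʳ v y)

Ad-linearˡ : ∀ y → IsLinear (λ A → Ad A y)
Ad-linearˡ y = bind-linearˡ (λ v → adʳ v y)

Ad-linearʳ : ∀ A → IsLinear (Ad A)
Ad-linearʳ A = bind-linearʳ A adʳ adʳ-linear

Ad-word : ∀ v y → Ad (word v) y ≋ adʳ v y
Ad-word v y = bind-word v (λ v → adʳ v y)

Ad-⊗ : ∀ A B y → Ad (A ⊗ B) y ≋ Ad B (Ad A y)
Ad-⊗ A B y = ≋-trans (bind-⊗ A B (λ t → adʳ t y))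
  (≋-trans (bind-congʳ A (λ u → bind-congʳ B (λ v → ≡⇒≋ (adʳ-++ u v y))))
  (≋-sym (lin-bind (Ad-linearʳ B) A (λ u → adʳ u y))))

Ad-lie : ∀ {f} → IsLie f → ∀ y → Ad f y ≋ ⟦ y , f ⟧
Ad-lie lie-x₀ y = Ad-word (𝕩₀ ∷ []) y
Ad-lie lie-x₁ y = Ad-word (𝕩₁ ∷ []) y
Ad-lie (lie-+ {f} {g} p q) y =
  ≋-trans (lin-⊕ (Ad-linearˡ y) f g)
  (≋-trans (⊕-cong (Ad-lie p y) (Ad-lie q y)) (≋-sym (lin-⊕ (⟦⟧-linearʳ y) f g)))
Ad-lie (lie-· {f} c p) y =
  ≋-trans (lin-· (Ad-linearˡ y) c f) (≋-trans (·-cong c (Ad-lie p y)) (≋-sym (lin-· (⟦⟧-linearʳ y) c f)))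
Ad-lie (lie-≈ {f} {g} p f≈g) y =
  ≋-trans (lin-cong (Ad-linearˡ y) (≋-sym (mk≋ {f} {g} f≈g)))
  (≋-trans (Ad-lie p y) (⟦⟧-cong (≋-refl {y}) (mk≋ {f} {g} f≈g)))
Ad-lie (lie-[] {f} {g} p q) y = begin
  Ad (f ⊗ g ⊖ g ⊗ f) y                  ≈⟨ lin-⊖ (Ad-linearˡ y) (f ⊗ g) (g ⊗ f) ⟩
  Ad (f ⊗ g) y ⊖ Ad (g ⊗ f) y           ≈⟨ ⊖-cong (Ad-⊗ f g y) (Ad-⊗ g f y) ⟩
  Ad g (Ad f y) ⊖ Ad f (Ad g y)         ≈⟨ ⊖-cong (lin-cong (Ad-linearʳ g) (Ad-lie p y))
                                                   (lin-cong (Ad-linearʳ f) (Ad-lie q y)) ⟩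
  Ad g ⟦ y , f ⟧ ⊖ Ad f ⟦ y , g ⟧       ≈⟨ ⊖-cong (Ad-lie q ⟦ y , f ⟧) (Ad-lie p ⟦ y , g ⟧) ⟩
  ⟦ ⟦ y , f ⟧ , g ⟧ ⊖ ⟦ ⟦ y , g ⟧ , f ⟧  ≈⟨ jacobi y f g ⟩
  ⟦ y , ⟦ f , g ⟧ ⟧                     ∎
  where open ≋-Reasoning

adSweedler : Word → Poly → Poly
adSweedler v y = Δ v (λ b₁ b₂ → (S b₁ ⊗ y) ⊗ word b₂)

S-∷ : ∀ e b → S (e ∷ b) ≋ ((- 1ℚ) · (S b ⊗ letter e))
S-∷ e b rewrite Listₚ.unfold-reverse e b = single-cong (reverse b ++ e ∷ [])
  (solve 1 (λ s → :- s := (:- con 1ℚ) :* (s :* con 1ℚ)) refl (signℚ (length b)))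

adSweedler-∷-term : ∀ e b₁ b₂ y →
  (((S (e ∷ b₁) ⊗ y) ⊗ word b₂) ⊕ ((S b₁ ⊗ y) ⊗ word (e ∷ b₂))) ≋ ((S b₁ ⊗ ⟦ y , letter e ⟧) ⊗ word b₂)
adSweedler-∷-term e b₁ b₂ y = begin
  ((S (e ∷ b₁) ⊗ y) ⊗ w₂) ⊕ ((Sb ⊗ y) ⊗ word (e ∷ b₂))   ≈⟨ ⊕-cong first second ⟩
  (- 1ℚ) · (Sb ⊗ ((x ⊗ y) ⊗ w₂)) ⊕ Sb ⊗ ((y ⊗ x) ⊗ w₂)    ≈⟨ ⊕-comm ((- 1ℚ) · (Sb ⊗ ((x ⊗ y) ⊗ w₂))) _ ⟩
  Sb ⊗ ((y ⊗ x) ⊗ w₂) ⊖ Sb ⊗ ((x ⊗ y) ⊗ w₂)              ≈⟨ lin-⊖ (⊗-linearʳ Sb) ((y ⊗ x) ⊗ w₂) ((x ⊗ y) ⊗ w₂) ⟨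
  Sb ⊗ ((y ⊗ x) ⊗ w₂ ⊖ (x ⊗ y) ⊗ w₂)                    ≈⟨ ⊗-congʳ Sb (lin-⊖ (⊗-linearˡ w₂) (y ⊗ x) (x ⊗ y)) ⟨
  Sb ⊗ (⟦ y , x ⟧ ⊗ w₂)                                  ≈⟨ ⊗-assoc Sb ⟦ y , x ⟧ w₂ ⟨
  (Sb ⊗ ⟦ y , x ⟧) ⊗ w₂                                  ∎
  where
  open ≋-Reasoning
  Sb = S b₁
  w₂ = word b₂
  x = letter e
  first : ((S (e ∷ b₁) ⊗ y) ⊗ w₂) ≋ ((- 1ℚ) · (Sb ⊗ ((x ⊗ y) ⊗ w₂)))
  first = begin
    (S (e ∷ b₁) ⊗ y) ⊗ w₂                 ≈⟨ lin-cong (linear-∘ (⊗-linearˡ w₂) (⊗-linearˡ y)) (S-∷ e b₁) ⟩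
    (((- 1ℚ) · (Sb ⊗ x)) ⊗ y) ⊗ w₂        ≈⟨ lin-· (linear-∘ (⊗-linearˡ w₂) (⊗-linearˡ y)) (- 1ℚ) (Sb ⊗ x) ⟩
    (- 1ℚ) · (((Sb ⊗ x) ⊗ y) ⊗ w₂)        ≈⟨ ·-cong (- 1ℚ) (≋-trans (⊗-congˡ w₂ (⊗-assoc Sb x y))
                                                                (⊗-assoc Sb (x ⊗ y) w₂)) ⟩
    (- 1ℚ) · (Sb ⊗ ((x ⊗ y) ⊗ w₂))        ∎
  second : ((Sb ⊗ y) ⊗ word (e ∷ b₂)) ≋ (Sb ⊗ ((y ⊗ x) ⊗ w₂))
  second = ≋-trans (⊗-congʳ (Sb ⊗ y) (word-∷ e b₂))
    (≋-trans (⊗-assoc Sb y (x ⊗ w₂)) (⊗-congʳ Sb (≋-sym (⊗-assoc y x w₂))))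

adʳ≋adSweedler : ∀ v y → adʳ v y ≋ adSweedler v y
adʳ≋adSweedler [] y = ≋-sym (≋-trans (⊕-identityʳ _) (≋-trans (⊗-identityʳ (𝟙 ⊗ y)) (⊗-identityˡ y)))
adʳ≋adSweedler (e ∷ v) y = ≋-trans (adʳ≋adSweedler v ⟦ y , letter e ⟧)
  (≋-sym (≋-trans (Δ-∷ e v (λ b₁ b₂ → (S b₁ ⊗ y) ⊗ word b₂))
                  (Δ-cong v (λ b₁ b₂ → adSweedler-∷-term e b₁ b₂ y))))

ΔP : Poly → (Word → Word → Poly) → Poly
ΔP A g = bind A (λ u → Δ u g)

bind-Δ : ∀ B u (H : Word → Word → Word → Poly) →
  bind B (λ v → Δ u (λ a b → H v a b)) ≋ Δ u (λ a b → bind B (λ v → H v a b))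
bind-Δ B u H = ≋-trans (bind-∑ B (deal 2 u) (λ v → uncurry₂ (H v)))
  (∑-cong (deal 2 u) (λ { (a ∷ b ∷ []) → ≋-refl }))

ΔP-⊗ : ∀ A B g → ΔP (A ⊗ B) g ≋ ΔP A (λ a₁ a₂ → ΔP B (λ b₁ b₂ → g (a₁ ++ b₁) (a₂ ++ b₂)))
ΔP-⊗ A B g = begin
  ΔP (A ⊗ B) g
    ≈⟨ bind-⊗ A B (λ t → Δ t g) ⟩
  bind A (λ u → bind B (λ v → Δ (u ++ v) g))
    ≈⟨ bind-congʳ A (λ u → bind-congʳ B (λ v → Δ-++ u v g)) ⟩
  bind A (λ u → bind B (λ v → Δ u (λ a₁ a₂ → Δ v (λ b₁ b₂ → g (a₁ ++ b₁) (a₂ ++ b₂)))))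
    ≈⟨ bind-congʳ A (λ u → bind-Δ B u (λ v a₁ a₂ → Δ v (λ b₁ b₂ → g (a₁ ++ b₁) (a₂ ++ b₂)))) ⟩
  ΔP A (λ a₁ a₂ → ΔP B (λ b₁ b₂ → g (a₁ ++ b₁) (a₂ ++ b₂)))
    ∎
  where open ≋-Reasoning

-- f is primitive: Δ f = f ⊗ 1 + 1 ⊗ f, tested against every bilinear g.
Primitive : Poly → Set
Primitive f = ∀ g → ΔP f g ≋ bind f (λ u → g u [] ⊕ g [] u)

letter-primitive : ∀ e → Primitive (letter e)
letter-primitive e g = ≋-trans (bind-word (e ∷ []) (λ u → Δ u g))
  (≋-trans (⊕-congʳ (g (e ∷ []) []) (⊕-identityʳ _)) (≋-sym (bind-word (e ∷ []) (λ u → g u [] ⊕ g [] u))))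

ΔP-⊗-primitive : ∀ f h → Primitive f → Primitive h → ∀ g →
  ΔP (f ⊗ h) g ≋ (bind f (λ u → bind h (λ v → g (u ++ v) [] ⊕ g [] (u ++ v)))
                 ⊕ bind f (λ u → bind h (λ v → g u v ⊕ g v u)))
ΔP-⊗-primitive f h pf ph g = begin
  ΔP (f ⊗ h) g
    ≈⟨ ΔP-⊗ f h g ⟩
  ΔP f (λ a₁ a₂ → ΔP h (shift a₁ a₂))
    ≈⟨ pf _ ⟩
  bind f (λ u → ΔP h (shift u []) ⊕ ΔP h (shift [] u))
    ≈⟨ bind-congʳ f (λ u → ⊕-cong (ph (shift u [])) (ph (shift [] u))) ⟩
  bind f (λ u → bind h (prim (shift u [])) ⊕ bind h (prim (shift [] u)))
    ≈⟨ bind-congʳ f (λ u → ≋-sym (bind-⊕ʳ h (prim (shift u [])) (prim (shift [] u)))) ⟩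
  bind f (λ u → bind h (λ v → prim (shift u []) v ⊕ prim (shift [] u) v))
    ≈⟨ bind-congʳ f (λ u → bind-congʳ h (regroup u)) ⟩
  bind f (λ u → bind h (λ v → prim g (u ++ v) ⊕ (g u v ⊕ g v u)))
    ≈⟨ bind-congʳ f (λ u → bind-⊕ʳ h _ _) ⟩
  bind f (λ u → bind h (λ v → prim g (u ++ v)) ⊕ bind h (λ v → g u v ⊕ g v u))
    ≈⟨ bind-⊕ʳ f _ _ ⟩
  bind f (λ u → bind h (λ v → prim g (u ++ v))) ⊕ bind f (λ u → bind h (λ v → g u v ⊕ g v u))
    ∎
  where
  open ≋-Reasoning
  prim : (Word → Word → Poly) → Word → Poly
  prim g u = g u [] ⊕ g [] u
  shift : Word → Word → Word → Word → Poly
  shift a₁ a₂ b₁ b₂ = g (a₁ ++ b₁) (a₂ ++ b₂)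
  regroup : ∀ u v → (prim (shift u []) v ⊕ prim (shift [] u) v) ≋ (prim g (u ++ v) ⊕ (g u v ⊕ g v u))
  regroup u v rewrite Listₚ.++-identityʳ u = ⊕-interchange′ (g (u ++ v) []) (g u v) (g v u) (g [] (u ++ v))

lie-primitive : ∀ {f} → IsLie f → Primitive f
lie-primitive lie-x₀ = letter-primitive 𝕩₀
lie-primitive lie-x₁ = letter-primitive 𝕩₁
lie-primitive (lie-+ {f} {h} p q) g = ≋-trans (lin-⊕ (bind-linearˡ _) f h)
  (≋-trans (⊕-cong (lie-primitive p g) (lie-primitive q g)) (≋-sym (lin-⊕ (bind-linearˡ _) f h)))
lie-primitive (lie-· {f} c p) g = ≋-trans (lin-· (bind-linearˡ _) c f)
  (≋-trans (·-cong c (lie-primitive p g)) (≋-sym (lin-· (bind-linearˡ _) c f)))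
lie-primitive (lie-≈ {f} {h} p f≈h) g = ≋-trans (bind-congˡ _ (≋-sym (mk≋ {f} {h} f≈h)))
  (≋-trans (lie-primitive p g) (bind-congˡ _ (mk≋ {f} {h} f≈h)))
lie-primitive (lie-[] {f} {h} p q) g = begin
  ΔP (f ⊗ h ⊖ h ⊗ f) g                          ≈⟨ lin-⊖ (bind-linearˡ _) (f ⊗ h) (h ⊗ f) ⟩
  ΔP (f ⊗ h) g ⊖ ΔP (h ⊗ f) g                   ≈⟨ ⊖-cong (ΔP-⊗-primitive f h pf ph g)
                                                           (ΔP-⊗-primitive h f ph pf g) ⟩
  (P f h ⊕ C f h) ⊖ (P h f ⊕ C h f)             ≈⟨ cross-terms-cancel ⟩
  P f h ⊖ P h f                                 ≈⟨ ⊖-cong (bind-⊗ f h prim) (bind-⊗ h f prim) ⟨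
  bind (f ⊗ h) prim ⊖ bind (h ⊗ f) prim         ≈⟨ lin-⊖ (bind-linearˡ prim) (f ⊗ h) (h ⊗ f) ⟨
  bind (f ⊗ h ⊖ h ⊗ f) prim                     ∎
  where
  open ≋-Reasoning
  pf = lie-primitive p
  ph = lie-primitive q
  prim : Word → Poly
  prim u = g u [] ⊕ g [] u
  P C : Poly → Poly → Poly
  P a b = bind a (λ u → bind b (λ v → prim (u ++ v)))
  C a b = bind a (λ u → bind b (λ v → g u v ⊕ g v u))
  cross-terms-cancel : ((P f h ⊕ C f h) ⊖ (P h f ⊕ C h f)) ≋ (P f h ⊖ P h f)
  cross-terms-cancel = ⊖-cancel-common (P f h) (P h f) (C f h) (C h f)
    (≋-trans (bind-congʳ f (λ u → bind-congʳ h (λ v → ⊕-comm (g u v) (g v u))))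
             (bind-swap f h (λ u v → g v u ⊕ g u v)))

counitScale : Poly → Poly → Poly
counitScale A y = bind A (λ u → ε u · y)

counitScale-linear : ∀ y → IsLinear (λ A → counitScale A y)
counitScale-linear y = bind-linearˡ (λ u → ε u · y)

counitScale-letter-⊗ : ∀ e Z y → counitScale (letter e ⊗ Z) y ≋ 𝟘
counitScale-letter-⊗ e Z y = ≋-trans (bind-⊗ (letter e) Z (λ u → ε u · y))
  (≋-trans (bind-word (e ∷ []) (λ u → bind Z (λ v → ε (u ++ v) · y)))
  (≋-trans (bind-congʳ Z (λ v → ·-zeroˡ y)) (bind-𝟘ʳ Z)))

counitScale-lie-⊗ : ∀ {f} → IsLie f → ∀ Z y → counitScale (f ⊗ Z) y ≋ 𝟘
counitScale-lie-⊗ lie-x₀ Z y = counitScale-letter-⊗ 𝕩₀ Z y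
counitScale-lie-⊗ lie-x₁ Z y = counitScale-letter-⊗ 𝕩₁ Z y
counitScale-lie-⊗ (lie-+ {f} {g} p q) Z y =
  ≋-trans (lin-cong (counitScale-linear y) (lin-⊕ (⊗-linearˡ Z) f g))
  (≋-trans (lin-⊕ (counitScale-linear y) (f ⊗ Z) (g ⊗ Z))
  (⊕-cong (counitScale-lie-⊗ p Z y) (counitScale-lie-⊗ q Z y)))
counitScale-lie-⊗ (lie-· {f} c p) Z y =
  ≋-trans (lin-cong (counitScale-linear y) (lin-· (⊗-linearˡ Z) c f))
  (≋-trans (lin-· (counitScale-linear y) c (f ⊗ Z)) (·-cong c (counitScale-lie-⊗ p Z y)))
counitScale-lie-⊗ (lie-[] {f} {g} p q) Z y =
  ≋-trans (lin-cong (counitScale-linear y) (⟦⟧-⊗ f g Z))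
  (≋-trans (lin-⊖ (counitScale-linear y) (f ⊗ (g ⊗ Z)) (g ⊗ (f ⊗ Z)))
  (⊖-cong (counitScale-lie-⊗ p (g ⊗ Z) y) (counitScale-lie-⊗ q (f ⊗ Z) y)))
counitScale-lie-⊗ (lie-≈ {f} {g} p f≈g) Z y =
  ≋-trans (lin-cong (counitScale-linear y) (⊗-congˡ Z (≋-sym (mk≋ {f} {g} f≈g)))) (counitScale-lie-⊗ p Z y)

product : List Poly → Poly
product [] = 𝟙
product (f ∷ fs) = f ⊗ product fs

word≋product : ∀ u → word u ≋ product (map letter u)
word≋product [] = ≋-refl
word≋product (e ∷ u) = ≋-trans (word-∷ e u) (⊗-congʳ (letter e) (word≋product u))

LieList : ℕ → List Poly → Set
LieList n fs = All IsLie fs × length fs ≡ n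

word-letters-lie : ∀ u → LieList (length u) (map letter u)
word-letters-lie [] = [] , refl
word-letters-lie (e ∷ u) = letter-lie e ∷ proj₁ (word-letters-lie u) , cong suc (proj₂ (word-letters-lie u))

module Action (_▷_ : Poly → Poly → Poly) (T : IsTriangle _▷_) where
  open IsTriangle T

  ▷-linearˡ : ∀ B → IsLinear (_▷ B)
  ▷-linearˡ B = record
    { lin-cong = λ p → mk≋ (▷-cong (get p) (λ _ → refl))
    ; lin-⊕ = λ A A′ → mk≋ (▷-+ˡ A A′ B)
    ; lin-· = λ c A → mk≋ (▷-·ˡ c A B) }

  ▷-linearʳ : ∀ A → IsLinear (A ▷_)
  ▷-linearʳ A = record
    { lin-cong = λ p → mk≋ (▷-cong (λ _ → refl) (get p))
    ; lin-⊕ = λ B B′ → mk≋ (▷-+ʳ A B B′)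
    ; lin-· = λ c B → mk≋ (▷-·ʳ c A B) }

  𝟙▷ : ∀ A → (𝟙 ▷ A) ≋ A
  𝟙▷ A = mk≋ (▷-unitˡ A)

  lie▷𝟙 : ∀ {f} → IsLie f → (f ▷ 𝟙) ≋ 𝟘
  lie▷𝟙 {f} lf = mk≋ (▷-unitʳ f lf)

  lie▷x₀ : ∀ {f} → IsLie f → (f ▷ X₀) ≋ 𝟘
  lie▷x₀ {f} lf = mk≋ (▷-d-x₀ f lf)

  lie▷x₁ : ∀ {f} → IsLie f → (f ▷ X₁) ≋ ⟦ X₁ , f ⟧
  lie▷x₁ {f} lf = mk≋ (▷-d-x₁ f lf)

  lie▷⟦⟧ : ∀ {f g h} → IsLie f → IsLie g → IsLie h → (f ▷ ⟦ g , h ⟧) ≋ (⟦ f ▷ g , h ⟧ ⊕ ⟦ g , f ▷ h ⟧)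
  lie▷⟦⟧ {f} {g} {h} lf lg lh = mk≋ (▷-d-der f g h lf lg lh)

  ▷-⊗ : ∀ A B C → (A ▷ (B ⊗ C)) ≋ ΔP A (λ a₁ a₂ → (word a₁ ▷ B) ⊗ (word a₂ ▷ C))
  ▷-⊗ A B C = ≋-trans (mk≋ (▷-coprod A B C)) (≋-trans (sweedler-bind 2 A _)
    (bind-congʳ A (λ u → ∑-cong (deal 2 u) (λ { (a₁ ∷ a₂ ∷ []) → ≋-refl }))))

  word▷⊗ : ∀ a B C → (word a ▷ (B ⊗ C)) ≋ Δ a (λ b₁ b₂ → (word b₁ ▷ B) ⊗ (word b₂ ▷ C))
  word▷⊗ a B C = ≋-trans (▷-⊗ (word a) B C) (bind-word a (λ u → Δ u (λ b₁ b₂ → (word b₁ ▷ B) ⊗ (word b₂ ▷ C))))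

  ▷-leibniz : ∀ {f} → IsLie f → ∀ B C → (f ▷ (B ⊗ C)) ≋ ((f ▷ B) ⊗ C ⊕ B ⊗ (f ▷ C))
  ▷-leibniz {f} lf B C = begin
    f ▷ (B ⊗ C)
      ≈⟨ ▷-⊗ f B C ⟩
    ΔP f (λ a₁ a₂ → (word a₁ ▷ B) ⊗ (word a₂ ▷ C))
      ≈⟨ lie-primitive lf _ ⟩
    bind f (λ u → (word u ▷ B) ⊗ (𝟙 ▷ C) ⊕ (𝟙 ▷ B) ⊗ (word u ▷ C))
      ≈⟨ bind-congʳ f (λ u → ⊕-cong (⊗-congʳ (word u ▷ B) (𝟙▷ C)) (⊗-congˡ (word u ▷ C) (𝟙▷ B))) ⟩
    bind f (λ u → (word u ▷ B) ⊗ C ⊕ B ⊗ (word u ▷ C))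
      ≈⟨ bind-⊕ʳ f _ _ ⟩
    bind f (λ u → (word u ▷ B) ⊗ C) ⊕ bind f (λ u → B ⊗ (word u ▷ C))
      ≈⟨ ⊕-cong (linear-as-bind (linear-∘ (⊗-linearˡ C) (▷-linearˡ B)) f)
                (linear-as-bind (linear-∘ (⊗-linearʳ B) (▷-linearˡ C)) f) ⟨
    (f ▷ B) ⊗ C ⊕ B ⊗ (f ▷ C)
      ∎
    where open ≋-Reasoning

  ▷-lie : ∀ {f g} → IsLie f → IsLie g → IsLie (f ▷ g)
  ▷-lie lf lie-x₀ = lie-≋ (lie-· 0ℚ lie-x₀) (≋-trans (·-zeroˡ X₀) (≋-sym (lie▷x₀ lf)))
  ▷-lie lf lie-x₁ = lie-≋ (lie-[] lie-x₁ lf) (≋-sym (lie▷x₁ lf))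
  ▷-lie {f} lf (lie-+ {g} {h} p q) = lie-≋ (lie-+ (▷-lie lf p) (▷-lie lf q)) (≋-sym (lin-⊕ (▷-linearʳ f) g h))
  ▷-lie {f} lf (lie-· {g} c p) = lie-≋ (lie-· c (▷-lie lf p)) (≋-sym (lin-· (▷-linearʳ f) c g))
  ▷-lie lf (lie-[] p q) = lie-≋ (lie-+ (lie-[] (▷-lie lf p) q) (lie-[] p (▷-lie lf q))) (≋-sym (lie▷⟦⟧ lf p q))
  ▷-lie {f} lf (lie-≈ {g} {h} p g≈h) = lie-≋ (▷-lie lf p) (lin-cong (▷-linearʳ f) (mk≋ {g} {h} g≈h))

  ▷-adʳ : ∀ {f} → IsLie f → ∀ v {y} → IsLie y → (f ▷ adʳ v y) ≋ (adʳ v (f ▷ y) ⊕ Ad (f ▷ word v) y)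
  ▷-adʳ {f} lf [] {y} ly = ≋-sym (≋-trans (⊕-congʳ (f ▷ y)
    (≋-trans (lin-cong (Ad-linearˡ y) (lie▷𝟙 lf)) (lin-𝟘 (Ad-linearˡ y)))) (⊕-identityʳ _))
  ▷-adʳ {f} lf (e ∷ v) {y} ly = begin
    f ▷ adʳ v ⟦ y , x ⟧
      ≈⟨ ▷-adʳ lf v (lie-[] ly (letter-lie e)) ⟩
    adʳ v (f ▷ ⟦ y , x ⟧) ⊕ Ad (f ▷ word v) ⟦ y , x ⟧
      ≈⟨ ⊕-congˡ _ (lin-cong (adʳ-linear v) (lie▷⟦⟧ lf ly (letter-lie e))) ⟩
    adʳ v (⟦ f ▷ y , x ⟧ ⊕ ⟦ y , f ▷ x ⟧) ⊕ Ad (f ▷ word v) ⟦ y , x ⟧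
      ≈⟨ ⊕-congˡ _ (lin-⊕ (adʳ-linear v) ⟦ f ▷ y , x ⟧ ⟦ y , f ▷ x ⟧) ⟩
    (adʳ v ⟦ f ▷ y , x ⟧ ⊕ adʳ v ⟦ y , f ▷ x ⟧) ⊕ Ad (f ▷ word v) ⟦ y , x ⟧
      ≈⟨ ⊕-assoc (adʳ v ⟦ f ▷ y , x ⟧) _ _ ⟩
    adʳ v ⟦ f ▷ y , x ⟧ ⊕ (adʳ v ⟦ y , f ▷ x ⟧ ⊕ Ad (f ▷ word v) ⟦ y , x ⟧)
      ≈⟨ ⊕-congʳ (adʳ v ⟦ f ▷ y , x ⟧) Ad-f▷ev ⟨
    adʳ v ⟦ f ▷ y , x ⟧ ⊕ Ad (f ▷ word (e ∷ v)) y
      ∎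
    where
    open ≋-Reasoning
    x = letter e
    Ad-f▷ev : Ad (f ▷ word (e ∷ v)) y ≋ (adʳ v ⟦ y , f ▷ x ⟧ ⊕ Ad (f ▷ word v) ⟦ y , x ⟧)
    Ad-f▷ev = begin
      Ad (f ▷ word (e ∷ v)) y
        ≈⟨ lin-cong (linear-∘ (Ad-linearˡ y) (▷-linearʳ f)) (word-∷ e v) ⟩
      Ad (f ▷ (x ⊗ word v)) y
        ≈⟨ lin-cong (Ad-linearˡ y) (▷-leibniz lf x (word v)) ⟩
      Ad ((f ▷ x) ⊗ word v ⊕ x ⊗ (f ▷ word v)) y
        ≈⟨ lin-⊕ (Ad-linearˡ y) ((f ▷ x) ⊗ word v) (x ⊗ (f ▷ word v)) ⟩
      Ad ((f ▷ x) ⊗ word v) y ⊕ Ad (x ⊗ (f ▷ word v)) y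
        ≈⟨ ⊕-cong (Ad-⊗ (f ▷ x) (word v) y) (Ad-⊗ x (f ▷ word v) y) ⟩
      Ad (word v) (Ad (f ▷ x) y) ⊕ Ad (f ▷ word v) (Ad x y)
        ≈⟨ ⊕-cong (lin-cong (Ad-linearʳ (word v)) (Ad-lie (▷-lie lf (letter-lie e)) y))
                  (lin-cong (Ad-linearʳ (f ▷ word v)) (Ad-lie (letter-lie e) y)) ⟩
      Ad (word v) ⟦ y , f ▷ x ⟧ ⊕ Ad (f ▷ word v) ⟦ y , x ⟧
        ≈⟨ ⊕-congˡ _ (Ad-word v ⟦ y , f ▷ x ⟧) ⟩
      adʳ v ⟦ y , f ▷ x ⟧ ⊕ Ad (f ▷ word v) ⟦ y , x ⟧
        ∎

  Ad-x₁-⊗ : ∀ {f} → IsLie f → ∀ P → Ad (f ⊗ P) X₁ ≋ ((f ▷ Ad P X₁) ⊖ Ad (f ▷ P) X₁)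
  Ad-x₁-⊗ {f} lf P = begin
    Ad (f ⊗ P) X₁                                         ≈⟨ Ad-⊗ f P X₁ ⟩
    Ad P (Ad f X₁)                                        ≈⟨ lin-cong (Ad-linearʳ P) (Ad-lie lf X₁) ⟩
    Ad P ⟦ X₁ , f ⟧                                       ≈⟨ ⊕-⊖-cancel (Ad P ⟦ X₁ , f ⟧) (Ad (f ▷ P) X₁) ⟨
    (Ad P ⟦ X₁ , f ⟧ ⊕ Ad (f ▷ P) X₁) ⊖ Ad (f ▷ P) X₁     ≈⟨ ⊖-cong (≋-sym f▷AdP) (≋-refl {Ad (f ▷ P) X₁}) ⟩
    (f ▷ Ad P X₁) ⊖ Ad (f ▷ P) X₁                         ∎
    where
    open ≋-Reasoning
    f▷AdP : (f ▷ Ad P X₁) ≋ (Ad P ⟦ X₁ , f ⟧ ⊕ Ad (f ▷ P) X₁)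
    f▷AdP = begin
      f ▷ Ad P X₁
        ≈⟨ lin-bind (▷-linearʳ f) P (λ v → adʳ v X₁) ⟩
      bind P (λ v → f ▷ adʳ v X₁)
        ≈⟨ bind-congʳ P (λ v → ▷-adʳ lf v lie-x₁) ⟩
      bind P (λ v → adʳ v (f ▷ X₁) ⊕ Ad (f ▷ word v) X₁)
        ≈⟨ bind-⊕ʳ P _ _ ⟩
      bind P (λ v → adʳ v (f ▷ X₁)) ⊕ bind P (λ v → Ad (f ▷ word v) X₁)
        ≈⟨ ⊕-cong (bind-congʳ P (λ v → lin-cong (adʳ-linear v) (lie▷x₁ lf)))
                  (≋-sym (linear-as-bind (linear-∘ (Ad-linearˡ X₁) (▷-linearʳ f)) P)) ⟩
      Ad P ⟦ X₁ , f ⟧ ⊕ Ad (f ▷ P) X₁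
        ∎

  ▷-counitScale-x₀ : ∀ {f} → IsLie f → ∀ P → (f ▷ counitScale P X₀) ≋ 𝟘
  ▷-counitScale-x₀ {f} lf P = ≋-trans (lin-bind (▷-linearʳ f) P (λ u → ε u · X₀))
    (≋-trans (bind-congʳ P (λ u → ≋-trans (lin-· (▷-linearʳ f) (ε u) X₀) (·-cong (ε u) (lie▷x₀ lf))))
    (bind-𝟘ʳ P))

  counitScale-▷ : ∀ {f} → IsLie f → ∀ P y → counitScale (f ▷ P) y ≋ 𝟘
  counitScale-▷ {f} lf P y =
    ≋-trans (linear-as-bind (linear-∘ (counitScale-linear y) (▷-linearʳ f)) P)
    (≋-trans (bind-congʳ P on-word) (bind-𝟘ʳ P))
    where
    on-word : ∀ v → counitScale (f ▷ word v) y ≋ 𝟘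
    on-word [] = ≋-trans (lin-cong (counitScale-linear y) (lie▷𝟙 lf)) (lin-𝟘 (counitScale-linear y))
    on-word (e ∷ v) =
      ≋-trans (lin-cong (linear-∘ (counitScale-linear y) (▷-linearʳ f)) (word-∷ e v))
      (≋-trans (lin-cong (counitScale-linear y) (▷-leibniz lf (letter e) (word v)))
      (≋-trans (lin-⊕ (counitScale-linear y) ((f ▷ letter e) ⊗ word v) (letter e ⊗ (f ▷ word v)))
      (⊕-cong (counitScale-lie-⊗ (▷-lie lf (letter-lie e)) (word v) y)
              (counitScale-lie-⊗ (letter-lie e) (f ▷ word v) y))))

  leibnizTerms : Poly → List Poly → List (List Poly)
  leibnizTerms f [] = []
  leibnizTerms f (g ∷ gs) = ((f ▷ g) ∷ gs) ∷ map (g ∷_) (leibnizTerms f gs)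

  ▷-product : ∀ {f} → IsLie f → ∀ gs → (f ▷ product gs) ≋ ∑ (leibnizTerms f gs) product
  ▷-product lf [] = lie▷𝟙 lf
  ▷-product {f} lf (g ∷ gs) = ≋-trans (▷-leibniz lf g (product gs)) (⊕-congʳ ((f ▷ g) ⊗ product gs)
    (≋-trans (⊗-congʳ g (▷-product lf gs))
    (≋-trans (⊗-∑ʳ g (leibnizTerms f gs) product) (≡⇒≋ (sym (∑-map (g ∷_) (leibnizTerms f gs) product))))))

  leibnizTerms-lie : ∀ {f} → IsLie f → ∀ n gs → LieList n gs → All (LieList n) (leibnizTerms f gs)
  leibnizTerms-lie lf n [] _ = []
  leibnizTerms-lie lf (suc n) (g ∷ gs) (lg ∷ lgs , refl) =
    (▷-lie lf lg ∷ lgs , refl)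
    ∷ gmap⁺ (λ { (l , e) → lg ∷ l , cong suc e }) (leibnizTerms-lie lf n gs (lgs , refl))

  -- Induction on the number of Lie factors: f ▷ P is a sum of products with as many factors as P.
  ▷-on-words : ∀ y → IsLie y → ∀ {Φ} → IsLinear Φ → (𝟙 ▷ y) ≋ Φ 𝟙 →
    (∀ {f} → IsLie f → ∀ P → Φ (f ⊗ P) ≋ ((f ▷ Φ P) ⊖ Φ (f ▷ P))) →
    ∀ u → (word u ▷ y) ≋ Φ (word u)
  ▷-on-words y ly {Φ} lΦ base step u =
    ≋-trans (lin-cong (▷-linearˡ y) (word≋product u))
    (≋-trans (on-products (length u) (map letter u) (word-letters-lie u))
    (lin-cong lΦ (≋-sym (word≋product u))))
    where
    on-products : ∀ n fs → LieList n fs → (product fs ▷ y) ≋ Φ (product fs)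
    on-products zero [] _ = base
    on-products (suc n) (f ∷ fs) (lf ∷ lfs , |fs|+1≡n+1) = begin
      (f ⊗ P) ▷ y                 ≈⟨ mk≋ (▷-assoc f P y lf ly) ⟩
      (f ▷ (P ▷ y)) ⊖ ((f ▷ P) ▷ y) ≈⟨ ⊖-cong (lin-cong (▷-linearʳ f) (on-products n fs lie-fs)) f▷P▷y ⟩
      (f ▷ Φ P) ⊖ Φ (f ▷ P)       ≈⟨ step lf P ⟨
      Φ (f ⊗ P)                   ∎
      where
      open ≋-Reasoning
      P = product fs
      lie-fs : LieList n fs
      lie-fs = lfs , ℕₚ.suc-injective |fs|+1≡n+1
      f▷P▷y : ((f ▷ P) ▷ y) ≋ Φ (f ▷ P)
      f▷P▷y = begin
        (f ▷ P) ▷ y                               ≈⟨ lin-cong (▷-linearˡ y) (▷-product lf fs) ⟩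
        ∑ (leibnizTerms f fs) product ▷ y         ≈⟨ lin-∑ (▷-linearˡ y) (leibnizTerms f fs) product ⟩
        ∑ (leibnizTerms f fs) (λ gs → product gs ▷ y)
          ≈⟨ ∑-cong-All (leibnizTerms f fs) (leibnizTerms-lie lf n fs lie-fs) (on-products n) ⟩
        ∑ (leibnizTerms f fs) (Φ ∘ product)       ≈⟨ lin-∑ lΦ (leibnizTerms f fs) product ⟨
        Φ (∑ (leibnizTerms f fs) product)         ≈⟨ lin-cong lΦ (▷-product lf fs) ⟨
        Φ (f ▷ P)                                 ∎

  word▷x₀ : ∀ u → (word u ▷ X₀) ≋ (ε u · X₀)
  word▷x₀ u = ≋-trans (▷-on-words X₀ lie-x₀ (counitScale-linear X₀)
      (≋-trans (𝟙▷ X₀) (≋-sym (bind-word [] (λ v → ε v · X₀))))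
      (λ lf P → ≋-trans (counitScale-lie-⊗ lf P X₀)
                  (≋-sym (⊖-cong (▷-counitScale-x₀ lf P) (counitScale-▷ lf P X₀))))
      u)
    (bind-word u (λ v → ε v · X₀))

  word▷x₁ : ∀ u → (word u ▷ X₁) ≋ adSweedler u X₁
  word▷x₁ u = ≋-trans (▷-on-words X₁ lie-x₁ (Ad-linearˡ X₁) (≋-trans (𝟙▷ X₁) (≋-sym (Ad-word [] X₁))) Ad-x₁-⊗ u)
    (≋-trans (Ad-word u X₁) (adʳ≋adSweedler u X₁))

  -- Expanding a ▷ (1 · 1) by the coproduct rule gives ψ a = Σ ψ(a₁) ψ(a₂) + 2 ψ a.
  -- In that sum either a₂ = [] and ψ [] = 0, or a₁ is shorter than a; so by
  -- induction on length ψ a = 2 ψ a, i.e. ψ a = 0.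
  φ ψ : Word → Poly
  φ b = word b ▷ 𝟙
  ψ b = φ b ⊖ ε b · 𝟙

  ψ-[] : ψ [] ≋ 𝟘
  ψ-[] = ≋-trans (⊖-cong (𝟙▷ 𝟙) (·-identityˡ 𝟙)) (⊖-self 𝟙)

  φ-⊗-φ : ∀ b₁ b₂ → (φ b₁ ⊗ φ b₂) ≋ (((ψ b₁ ⊗ ψ b₂ ⊕ ε b₂ · ψ b₁) ⊕ ε b₁ · ψ b₂) ⊕ ε b₁ · (ε b₂ · 𝟙))
  φ-⊗-φ b₁ b₂ = begin
    φ b₁ ⊗ φ b₂
      ≈⟨ ⊗-cong (≋-sym (⊖-⊕-cancel (φ b₁) E₁)) (≋-sym (⊖-⊕-cancel (φ b₂) E₂)) ⟩
    (ψ b₁ ⊕ E₁) ⊗ (ψ b₂ ⊕ E₂)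
      ≈⟨ lin-⊕ (⊗-linearˡ (ψ b₂ ⊕ E₂)) (ψ b₁) E₁ ⟩
    ψ b₁ ⊗ (ψ b₂ ⊕ E₂) ⊕ E₁ ⊗ (ψ b₂ ⊕ E₂)
      ≈⟨ ⊕-cong (lin-⊕ (⊗-linearʳ (ψ b₁)) (ψ b₂) E₂) (lin-⊕ (⊗-linearʳ E₁) (ψ b₂) E₂) ⟩
    (ψ b₁ ⊗ ψ b₂ ⊕ ψ b₁ ⊗ E₂) ⊕ (E₁ ⊗ ψ b₂ ⊕ E₁ ⊗ E₂)
      ≈⟨ ⊕-cong (⊕-congʳ (ψ b₁ ⊗ ψ b₂) (⊗-scaled𝟙 (ε b₂) (ψ b₁)))
                (⊕-cong (scaled𝟙-⊗ (ε b₁) (ψ b₂)) (scaled𝟙-⊗ (ε b₁) E₂)) ⟩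
    (ψ b₁ ⊗ ψ b₂ ⊕ ε b₂ · ψ b₁) ⊕ (ε b₁ · ψ b₂ ⊕ ε b₁ · E₂)
      ≈⟨ ⊕-assoc (ψ b₁ ⊗ ψ b₂ ⊕ ε b₂ · ψ b₁) _ _ ⟨
    ((ψ b₁ ⊗ ψ b₂ ⊕ ε b₂ · ψ b₁) ⊕ ε b₁ · ψ b₂) ⊕ ε b₁ · E₂
      ∎
    where
    open ≋-Reasoning
    E₁ = ε b₁ · 𝟙
    E₂ = ε b₂ · 𝟙

  φ-recursion : ∀ a → φ a ≋ (((Δ a (λ b₁ b₂ → ψ b₁ ⊗ ψ b₂) ⊕ ψ a) ⊕ ψ a) ⊕ ε a · 𝟙)
  φ-recursion a = begin
    φ a
      ≈⟨ lin-cong (▷-linearʳ (word a)) (≋-sym (⊗-identityˡ 𝟙)) ⟩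
    word a ▷ (𝟙 ⊗ 𝟙)
      ≈⟨ word▷⊗ a 𝟙 𝟙 ⟩
    Δ a (λ b₁ b₂ → φ b₁ ⊗ φ b₂)
      ≈⟨ Δ-cong a φ-⊗-φ ⟩
    Δ a (λ b₁ b₂ → ((ψ b₁ ⊗ ψ b₂ ⊕ ε b₂ · ψ b₁) ⊕ ε b₁ · ψ b₂) ⊕ ε b₁ · (ε b₂ · 𝟙))
      ≈⟨ ≋-trans (Δ-⊕ a _ _) (⊕-congˡ _ (≋-trans (Δ-⊕ a _ _) (⊕-congˡ _ (Δ-⊕ a _ _)))) ⟩
    ((Δ a (λ b₁ b₂ → ψ b₁ ⊗ ψ b₂) ⊕ Δ a (λ b₁ b₂ → ε b₂ · ψ b₁)) ⊕ Δ a (λ b₁ b₂ → ε b₁ · ψ b₂))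
      ⊕ Δ a (λ b₁ b₂ → ε b₁ · (ε b₂ · 𝟙))
      ≈⟨ ⊕-cong (⊕-cong (⊕-congʳ _ (Δ-counitʳ a ψ)) (Δ-counitˡ a ψ)) (Δ-counitˡ a (λ b → ε b · 𝟙)) ⟩
    ((Δ a (λ b₁ b₂ → ψ b₁ ⊗ ψ b₂) ⊕ ψ a) ⊕ ψ a) ⊕ ε a · 𝟙
      ∎
    where open ≋-Reasoning

  ψ≋𝟘 : ∀ n a → length a < n → ψ a ≋ 𝟘
  ψ≋𝟘 (suc n) a (s≤s |a|≤n) = mk≋ λ w → x≡x+x⇒x≡0 (trans (get ψ≋2ψ w) (coeff-⊕ (ψ a) (ψ a) w))
    where
    product-terms : ∀ v → SplitsLength a v → uncurry₂ (λ b₁ b₂ → ψ b₁ ⊗ ψ b₂) v ≋ 𝟘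
    product-terms (b₁ ∷ [] ∷ []) _ = ≋-trans (⊗-congʳ (ψ b₁) ψ-[]) (lin-𝟘 (⊗-linearʳ (ψ b₁)))
    product-terms (b₁ ∷ (x ∷ b₂) ∷ []) |b₁|+|xb₂|≡|a| = ⊗-congˡ (ψ (x ∷ b₂)) (ψ≋𝟘 n b₁ |b₁|<n)
      where
      |b₁|<n : length b₁ < n
      |b₁|<n = ℕₚ.<-≤-trans (subst (length b₁ <_) |b₁|+|xb₂|≡|a| (ℕₚ.m<m+n (length b₁) (s≤s z≤n))) |a|≤n
    ψ≋2ψ : ψ a ≋ (ψ a ⊕ ψ a)
    ψ≋2ψ = begin
      ψ a
        ≈⟨ ⊖-cong (φ-recursion a) (≋-refl {ε a · 𝟙}) ⟩
      (((Δ a (λ b₁ b₂ → ψ b₁ ⊗ ψ b₂) ⊕ ψ a) ⊕ ψ a) ⊕ ε a · 𝟙) ⊖ ε a · 𝟙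
        ≈⟨ ⊕-⊖-cancel _ (ε a · 𝟙) ⟩
      (Δ a (λ b₁ b₂ → ψ b₁ ⊗ ψ b₂) ⊕ ψ a) ⊕ ψ a
        ≈⟨ ⊕-congˡ (ψ a) (⊕-congˡ (ψ a)
             (≋-trans (∑-cong-All (deal 2 a) (deal2-lengths a) product-terms) (∑-𝟘 (deal 2 a)))) ⟩
      ψ a ⊕ ψ a
        ∎
      where open ≋-Reasoning

  word▷𝟙 : ∀ a → (word a ▷ 𝟙) ≋ (ε a · 𝟙)
  word▷𝟙 a = ≋-trans (≋-sym (⊖-⊕-cancel (φ a) (ε a · 𝟙)))
    (⊕-congˡ (ε a · 𝟙) (ψ≋𝟘 (suc (length a)) a (s≤s ℕₚ.≤-refl)))

  word▷x₀^++ : ∀ k a W → (word a ▷ word (x₀^ k ++ W)) ≋ (word (x₀^ k) ⊗ (word a ▷ word W))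
  word▷x₀^++ zero a W = ≋-sym (⊗-identityˡ _)
  word▷x₀^++ (suc k) a W = begin
    word a ▷ word (𝕩₀ ∷ R)
      ≈⟨ lin-cong (▷-linearʳ (word a)) (word-∷ 𝕩₀ R) ⟩
    word a ▷ (X₀ ⊗ word R)
      ≈⟨ word▷⊗ a X₀ (word R) ⟩
    Δ a (λ b₁ b₂ → (word b₁ ▷ X₀) ⊗ (word b₂ ▷ word R))
      ≈⟨ Δ-cong a (λ b₁ b₂ → ≋-trans (⊗-congˡ (word b₂ ▷ word R) (word▷x₀ b₁))
                                    (lin-· (⊗-linearˡ (word b₂ ▷ word R)) (ε b₁) X₀)) ⟩
    Δ a (λ b₁ b₂ → ε b₁ · (X₀ ⊗ (word b₂ ▷ word R)))
      ≈⟨ Δ-counitˡ a (λ b → X₀ ⊗ (word b ▷ word R)) ⟩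
    X₀ ⊗ (word a ▷ word R)
      ≈⟨ ⊗-congʳ X₀ (word▷x₀^++ k a W) ⟩
    X₀ ⊗ (word (x₀^ k) ⊗ (word a ▷ word W))
      ≈⟨ ⊗-assoc X₀ (word (x₀^ k)) _ ⟨
    (X₀ ⊗ word (x₀^ k)) ⊗ (word a ▷ word W)
      ≈⟨ ⊗-congˡ (word a ▷ word W) (word-⊗-word (𝕩₀ ∷ []) (x₀^ k)) ⟩
    word (x₀^ (suc k)) ⊗ (word a ▷ word W)
      ∎
    where
    open ≋-Reasoning
    R = x₀^ k ++ W

  word▷x₀^ : ∀ k a → (word a ▷ word (x₀^ k)) ≋ (ε a · word (x₀^ k))
  word▷x₀^ k a = begin
    word a ▷ word (x₀^ k)              ≡⟨ cong (λ z → word a ▷ word z) (sym (Listₚ.++-identityʳ (x₀^ k))) ⟩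
    word a ▷ word (x₀^ k ++ [])        ≈⟨ word▷x₀^++ k a [] ⟩
    word (x₀^ k) ⊗ (word a ▷ 𝟙)        ≈⟨ ⊗-congʳ (word (x₀^ k)) (word▷𝟙 a) ⟩
    word (x₀^ k) ⊗ (ε a · 𝟙)           ≈⟨ ⊗-scaled𝟙 (ε a) (word (x₀^ k)) ⟩
    ε a · word (x₀^ k)                 ∎
    where open ≋-Reasoning

  word▷x₁∷ : ∀ a W →
    (word a ▷ word (𝕩₁ ∷ W)) ≋ Δ a (λ b₁ b₂ → Δ b₁ (λ c p → (S c ⊗ X₁) ⊗ word p) ⊗ (word b₂ ▷ word W))
  word▷x₁∷ a W = ≋-trans (lin-cong (▷-linearʳ (word a)) (word-∷ 𝕩₁ W)) (≋-trans (word▷⊗ a X₁ (word W))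
    (Δ-cong a (λ b₁ b₂ → ⊗-congˡ (word b₂ ▷ word W) (word▷x₁ b₁))))

  GLword : Word → Poly → Poly
  GLword u W = Δ u (λ a₁ a₂ → word a₁ ⊗ (word a₂ ▷ W))

  GL≋bind-GLword : ∀ A W → GL _▷_ A W ≋ bind A (λ u → GLword u W)
  GL≋bind-GLword A W = ≋-trans (sweedler-bind 2 A _)
    (bind-congʳ A (λ u → ∑-cong (deal 2 u) (λ { (a₁ ∷ a₂ ∷ []) → ≋-refl })))

  GLword-x₀^ : ∀ k u → GLword u (word (x₀^ k)) ≋ word (u ++ x₀^ k)
  GLword-x₀^ k u = begin
    GLword u (word (x₀^ k))
      ≈⟨ Δ-cong u (λ a₁ a₂ → ≋-trans (⊗-congʳ (word a₁) (word▷x₀^ k a₂))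
                                    (lin-· (⊗-linearʳ (word a₁)) (ε a₂) (word (x₀^ k)))) ⟩
    Δ u (λ a₁ a₂ → ε a₂ · (word a₁ ⊗ word (x₀^ k)))
      ≈⟨ Δ-counitʳ u (λ a₁ → word a₁ ⊗ word (x₀^ k)) ⟩
    word u ⊗ word (x₀^ k)
      ≈⟨ word-⊗-word u (x₀^ k) ⟩
    word (u ++ x₀^ k)
      ∎
    where open ≋-Reasoning

  -- Only one coproduct factor of u acts on the letter x₁, contributing S(u₍₂₎) x₁ u₍₃₎;
  -- coassociativity regroups the factors so that GLword reappears on the tail of w.
  GLword-x₀^x₁ : ∀ k W u → GLword u (word (x₀^ k ++ 𝕩₁ ∷ W))
    ≋ Δ u (λ a b → Δ b (λ c r → ((word (a ++ x₀^ k) ⊗ S c) ⊗ X₁) ⊗ GLword r (word W)))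
  GLword-x₀^x₁ k W u = begin
    GLword u (word (x₀^ k ++ 𝕩₁ ∷ W))
      ≈⟨ Δ-cong u (λ a b → ≋-trans (⊗-congʳ (word a) (word▷x₀^++ k b (𝕩₁ ∷ W)))
                                  (lin-cong (prefix-linear a) (word▷x₁∷ b W))) ⟩
    Δ u (λ a b → prefix a (Δ b (λ b₁ q → Δ b₁ (λ c p → (S c ⊗ X₁) ⊗ word p) ⊗ (word q ▷ word W))))
      ≈⟨ Δ-cong u (λ a b → ≋-trans (lin-Δ (prefix-linear a) b _) (Δ-cong b (λ b₁ q →
           lin-Δ (linear-∘ (prefix-linear a) (⊗-linearˡ (word q ▷ word W))) b₁ _))) ⟩
    Δ u (λ a b → Δ b (λ b₁ q → Δ b₁ (λ c p → H a c p q)))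
      ≈⟨ Δ-cong u (λ a b → Δ-coassoc b (H a)) ⟩
    Δ u (λ a b → Δ b (λ c r → Δ r (λ p q → H a c p q)))
      ≈⟨ Δ-cong u (λ a b → Δ-cong b (λ c r → ≋-trans (Δ-cong r (reassociate a c))
           (≋-sym (lin-Δ (⊗-linearʳ (Z a c)) r (λ p q → word p ⊗ (word q ▷ word W)))))) ⟩
    Δ u (λ a b → Δ b (λ c r → Z a c ⊗ GLword r (word W)))
      ∎
    where
    open ≋-Reasoning
    prefix : Word → Poly → Poly
    prefix a P = word a ⊗ (word (x₀^ k) ⊗ P)
    prefix-linear : ∀ a → IsLinear (prefix a)
    prefix-linear a = linear-∘ (⊗-linearʳ (word a)) (⊗-linearʳ (word (x₀^ k)))
    H : Word → Word → Word → Word → Poly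
    H a c p q = prefix a (((S c ⊗ X₁) ⊗ word p) ⊗ (word q ▷ word W))
    Z : Word → Word → Poly
    Z a c = (word (a ++ x₀^ k) ⊗ S c) ⊗ X₁
    reassociate : ∀ a c p q → H a c p q ≋ (Z a c ⊗ (word p ⊗ (word q ▷ word W)))
    reassociate a c p q = begin
      word a ⊗ (word (x₀^ k) ⊗ (((S c ⊗ X₁) ⊗ word p) ⊗ Y))   ≈⟨ ⊗-assoc (word a) (word (x₀^ k)) _ ⟨
      (word a ⊗ word (x₀^ k)) ⊗ (((S c ⊗ X₁) ⊗ word p) ⊗ Y)   ≈⟨ ⊗-congˡ _ (word-⊗-word a (x₀^ k)) ⟩
      word (a ++ x₀^ k) ⊗ (((S c ⊗ X₁) ⊗ word p) ⊗ Y)         ≈⟨ ⊗-congʳ (word (a ++ x₀^ k)) S-x₁-p-Y ⟩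
      word (a ++ x₀^ k) ⊗ (S c ⊗ (X₁ ⊗ (word p ⊗ Y)))         ≈⟨ ⊗-assoc (word (a ++ x₀^ k)) (S c) _ ⟨
      (word (a ++ x₀^ k) ⊗ S c) ⊗ (X₁ ⊗ (word p ⊗ Y))         ≈⟨ ⊗-assoc (word (a ++ x₀^ k) ⊗ S c) X₁ _ ⟨
      Z a c ⊗ (word p ⊗ Y)                                    ∎
      where
      Y = word q ▷ word W
      S-x₁-p-Y : (((S c ⊗ X₁) ⊗ word p) ⊗ Y) ≋ (S c ⊗ (X₁ ⊗ (word p ⊗ Y)))
      S-x₁-p-Y = ≋-trans (⊗-assoc (S c ⊗ X₁) (word p) Y) (⊗-assoc (S c) X₁ (word p ⊗ Y))

  GLword-wordW : ∀ d ks u → GLword u (word (wordW d ks)) ≋ ∑ (deal (suc (twice d)) u) (rhsTerm d ks)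
  GLword-wordW zero (k ∷ []) u = ≋-trans (GLword-x₀^ k u) (≋-sym (deal-1 u (rhsTerm zero (k ∷ []))))
  GLword-wordW (suc d) (k ∷ ks) u = begin
    GLword u (word (x₀^ k ++ 𝕩₁ ∷ wordW d ks))
      ≈⟨ GLword-x₀^x₁ k (wordW d ks) u ⟩
    Δ u (λ a b → Δ b (λ c r → Z a c ⊗ GLword r (word (wordW d ks))))
      ≈⟨ Δ-cong u (λ a b → Δ-cong b (λ c r →
           ≋-trans (⊗-congʳ (Z a c) (GLword-wordW d ks r)) (⊗-∑ʳ (Z a c) (deal m r) (rhsTerm d ks)))) ⟩
    Δ u (λ a b → Δ b (λ c r → ∑ (deal m r) (λ v → rhsTerm (suc d) (k ∷ ks) (a ∷ c ∷ v))))
      ≈⟨ Δ-cong u (λ a b → deal-suc m b (λ v → rhsTerm (suc d) (k ∷ ks) (a ∷ v))) ⟨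
    Δ u (λ a b → ∑ (deal (suc m) b) (λ v → rhsTerm (suc d) (k ∷ ks) (a ∷ v)))
      ≈⟨ deal-suc (suc m) u (rhsTerm (suc d) (k ∷ ks)) ⟨
    ∑ (deal (suc (suc m)) u) (rhsTerm (suc d) (k ∷ ks))
      ∎
    where
    open ≋-Reasoning
    m = suc (twice d)
    Z : Word → Word → Poly
    Z a c = (word (a ++ x₀^ k) ⊗ S c) ⊗ X₁

proposition3p18 : (_▷_ : Poly → Poly → Poly) → IsTriangle _▷_ →
    (A : Poly) (d : ℕ) (ks : Vec ℕ (suc d)) →
    GL _▷_ A (word (wordW d ks)) ≈ sweedler (suc (twice d)) A (rhsTerm d ks)
proposition3p18 _▷_ T A d ks = get (begin
  GL _▷_ A (word (wordW d ks))
    ≈⟨ GL≋bind-GLword A (word (wordW d ks)) ⟩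
  bind A (λ u → GLword u (word (wordW d ks)))
    ≈⟨ bind-congʳ A (GLword-wordW d ks) ⟩
  bind A (λ u → ∑ (deal (suc (twice d)) u) (rhsTerm d ks))
    ≈⟨ sweedler-bind (suc (twice d)) A (rhsTerm d ks) ⟨
  sweedler (suc (twice d)) A (rhsTerm d ks)
    ∎)
  where
  open ≋-Reasoning
  open Action _▷_ T
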